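{- For $n\ge 1$ let $d^{AB}_n$ denote the number of derangements $\sigma\in B_n$ with $\ell_B(\sigma)$ even. Then: (i) For $n\ge 1$, $\displaystyle d^{AB}_n=n!\sum_{k=0}^{n-1}\frac{2^{n-k-1}(-1)^k}{k!}+(-1)^n$. (ii) For $n\ge 2$, $d^{AB}_n=2n\,d^{AB}_{n-1}+(-1)^n(n+1)$, with $d^{AB}_1=0$. (iii) For $n\ge 3$, $d^{AB}_n=(n-1)\bigl(2d^{AB}_{n-1}+4d^{AB}_{n-2}+(-1)^{n-1}\bigr)$, with $d^{AB}_1=0$, $d^{AB}_2=3$.
   Context: $B_n$ is the hyperoctahedral group of signed permutations of $[n]$: words $\sigma=\sigma_1\cdots\sigma_n$ with $\sigma_i\in\{\pm1,\dots,\pm n\}$ such that $|\sigma_1|\cdots|\sigma_n|$ is a permutation of $[n]$. A derangement is a $\sigma\in B_n$ with $\sigma_i\ne i$ for all $i$ (so $\sigma_i=-i$ is allowed). The (Coxeter) length is $\ell_B(\sigma)=\mathrm{inv}(\sigma)-\sum_{i:\sigma_i<0}\sigma_i$, where $\mathrm{inv}(\sigma)=\#\{(i,j):i<j,\ \sigma_i>\sigma_j\}$ computed with the usual order of integers. -}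

module Defs where

open import Data.Nat as ℕ using (ℕ; zero; suc; _!; _∸_)
open import Data.Nat.Properties using (_!≢0)
open import Data.Integer as ℤ using (ℤ; +_; -_; ∣_∣)
open import Data.Bool using (Bool; true; false; _∧_; if_then_else_)
open import Data.List using (List; []; _∷_; map; concatMap; filter; length; upTo; zip)
open import Data.Bool.ListAction using (all)
open import Data.Nat.ListAction using (sum)
open import Relation.Nullary.Decidable using (does)
open import Data.Rational as ℚ using (ℚ)

range : ℕ → List ℕ
range n = map suc (upTo n)

letters : ℕ → List ℤ
letters n = map (λ k → + k) (range n) Data.List.++ map (λ k → - (+ k)) (range n)

words : List ℤ → ℕ → List (List ℤ)
words A zero    = [] ∷ []
words A (suc m) = concatMap (λ w → map (λ a → a ∷ w) A) (words A m)

count : ℕ → List ℕ → ℕ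
count k []       = 0
count k (x ∷ xs) = if does (k ℕ.≟ x) then suc (count k xs) else count k xs

isSignedPerm : ℕ → List ℤ → Bool
isSignedPerm n σ = all (λ k → does (count k (map ∣_∣ σ) ℕ.≟ 1)) (range n)

-- signed permutations of [n] (the group B_n), as words σ₁⋯σₙ
Bn : ℕ → List (List ℤ)
Bn n = filter (λ σ → isSignedPerm n σ ≡ᵇ true) (words (letters n) n)
  where
  open import Data.Bool.Properties using () renaming (_≟_ to _≡ᵇ_)

isDerangement : List ℤ → Bool
isDerangement σ = all (λ p → Data.Bool.not (does (ℤ._≟_ (Data.Product.proj₂ p) (+ Data.Product.proj₁ p))))
                      (zip (range (length σ)) σ)
  where import Data.Product

inv : List ℤ → ℕ
inv []       = 0
inv (x ∷ xs) = length (filter (λ y → y ℤ.<? x) xs) ℕ.+ inv xs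

negSum : List ℤ → ℕ
negSum σ = sum (map ∣_∣ (filter (λ x → x ℤ.<? + 0) σ))

-- Coxeter length ℓ_B(σ) = inv(σ) - Σ_{σ_i<0} σ_i
ℓB : List ℤ → ℕ
ℓB σ = inv σ ℕ.+ negSum σ

isEven : ℕ → Bool
isEven n = does (n ℕ.% 2 ℕ.≟ 0)

dAB : ℕ → ℕ
dAB n = length (filter (λ σ → (isDerangement σ ∧ isEven (ℓB σ)) Data.Bool.Properties.≟ true) (Bn n))
  where import Data.Bool.Properties

sgn : ℕ → ℤ
sgn k = (- (+ 1)) ℤ.^ k

sumℚ : ℕ → (ℕ → ℚ) → ℚ
sumℚ zero    f = ℚ.0ℚ
sumℚ (suc m) f = sumℚ m f ℚ.+ f m

term : ℕ → ℕ → ℚ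
term n k = ((sgn k ℤ.* + (2 ℕ.^ (n ∸ k ∸ 1))) ℚ./ (k !)) {{k !≢0}}

-- Since ℓ_B(σ) ≡ inv|σ| + neg σ (mod 2), where inv|σ| counts the inversions of the absolute values and neg σ the
-- negative entries, 2 d^{AB}_n = D_n + S_n, with D_n the number of derangements in B_n and S_n the sum of
-- (−1)^{inv|σ| + neg σ} over them.  For the parity: −Σ_{σᵢ<0} σᵢ = neg σ + Σ_{σᵢ<0} #{j : |σⱼ| < |σᵢ|}, and for
-- i < j the contributions [σⱼ < σᵢ] + [σᵢ < 0, |σⱼ| < |σᵢ|] + [σⱼ < 0, |σᵢ| < |σⱼ|] have the parity of [|σⱼ| < |σᵢ|].
-- Both D_n and S_n are computed by removing the first letter, which leaves a partial derangement: a set of values to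
-- be placed on the remaining positions.  In S_n the two signs of a first letter cancel, except for the smallest
-- remaining value, which fits only with a minus sign; hence S_n = (−1)^n.  The number of partial derangements depends
-- only on their size m and on the number k of values that could be fixed points; inclusion–exclusion gives the table
-- avoid m k, whose diagonal D_n satisfies D_{n+1} = 2(n+1) D_n + (−1)^{n+1}.  This yields (ii), and (iii) and the
-- explicit formula (i) follow from (ii) by algebra.

module Submission where

open import Defs
open import Data.Nat as ℕ using (ℕ; suc; _≥_; _!)
open import Data.Integer as ℤ using (ℤ; +_)
open import Data.Rational as ℚ using (ℚ)
open import Data.Product using (_×_)
open import Relation.Binary.PropositionalEquality using (_≡_)

open import Data.Bool using (Bool; true; false; T; not; _∧_; if_then_else_)
import Data.Bool.Properties as 𝔹P
open import Data.Bool.ListAction using (all)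
open import Data.Empty using (⊥-elim)
open import Data.Integer using (0ℤ; 1ℤ; _+_; _*_; -_; _-_; ∣_∣; -[1+_])
import Data.Integer.Properties as ℤP
open import Data.Integer.Tactic.RingSolver using (solve-∀)
open import Data.List using (List; []; _∷_; _++_; map; concatMap; filter; length; upTo; applyUpTo; zip)
import Data.List.Properties as ListP
open import Data.List.Relation.Unary.All using (All; []; _∷_)
open import Data.Nat using (zero; _≤_; _<_; z≤n; s≤s; _∸_; _^_; _≡ᵇ_; _<ᵇ_)
open import Data.Nat.Properties as ℕP using (_!≢0)
open import Data.Nat.Tactic.RingSolver using () renaming (solve-∀ to ℕ-solve-∀)
open import Data.Product using (_,_; proj₁; proj₂)
import Data.Rational.Properties as ℚP
open import Data.Rational.Solver using (module +-*-Solver)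
open import Data.Rational.Unnormalised as ℚᵘ using (mkℚᵘ; *≡*) renaming (_≃_ to _≃ᵘ_)
import Data.Rational.Unnormalised.Properties as ℚᵘP
open import Data.Sum using (inj₁; inj₂)
open import Function.Bundles using (Equivalence)
open import Relation.Binary.Definitions using (tri<; tri≈; tri>)
open import Relation.Binary.PropositionalEquality using (_≢_; refl; sym; trans; cong; cong₂; module ≡-Reasoning)
open import Relation.Nullary.Decidable using (Dec; does; yes; no)
open import Relation.Unary using (Pred; Decidable)

open +-*-Solver using (_:+_; _:*_; _:=_) renaming (solve to ℚ-solve)
open import Algebra.Properties.CommutativeSemigroup ℕP.+-commutativeSemigroup using ()
  renaming (interchange to ℕ-+-interchange)
open import Algebra.Properties.CommutativeSemigroup ℤP.+-commutativeSemigroup using ()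
  renaming (interchange to +-interchange)
open import Algebra.Properties.CommutativeSemigroup ℤP.*-commutativeSemigroup using ()
  renaming (interchange to *-interchange)

𝟙 : Bool → ℕ
𝟙 true  = 1
𝟙 false = 0

𝟙ℤ : Bool → ℤ
𝟙ℤ b = + 𝟙 b

𝟙-∧ : ∀ a b → 𝟙 a ℕ.* 𝟙 b ≡ 𝟙 (a ∧ b)
𝟙-∧ true  true  = refl
𝟙-∧ true  false = refl
𝟙-∧ false b     = refl

𝟙ℤ-∧-interchange : ∀ a b c d → 𝟙ℤ ((a ∧ b) ∧ (c ∧ d)) ≡ 𝟙ℤ a * 𝟙ℤ c * 𝟙ℤ (b ∧ d)
𝟙ℤ-∧-interchange true  b true  d = sym (ℤP.*-identityˡ _)
𝟙ℤ-∧-interchange true  b false d = cong 𝟙ℤ (𝔹P.∧-zeroʳ b)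
𝟙ℤ-∧-interchange false b c     d = refl

does-≟true : ∀ b → does (b 𝔹P.≟ true) ≡ b
does-≟true true  = refl
does-≟true false = refl

true⇒T : ∀ {b} → b ≡ true → T b
true⇒T = Equivalence.from 𝔹P.T-≡

≡ᵇ-refl : ∀ m → (m ≡ᵇ m) ≡ true
≡ᵇ-refl m = Equivalence.to 𝔹P.T-≡ (ℕP.≡⇒≡ᵇ m m refl)

≡ᵇ⇒≡ : ∀ m n → (m ≡ᵇ n) ≡ true → m ≡ n
≡ᵇ⇒≡ m n eq = ℕP.≡ᵇ⇒≡ m n (true⇒T eq)

≢⇒≡ᵇ-false : ∀ m n → m ≢ n → (m ≡ᵇ n) ≡ false
≢⇒≡ᵇ-false m n m≢n with m ≡ᵇ n in eq
... | true  = ⊥-elim (m≢n (≡ᵇ⇒≡ m n eq))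
... | false = refl

<⇒<ᵇ-true : ∀ {m n} → m < n → (m <ᵇ n) ≡ true
<⇒<ᵇ-true m<n = Equivalence.to 𝔹P.T-≡ (ℕP.<⇒<ᵇ m<n)

<ᵇ-true⇒< : ∀ m n → (m <ᵇ n) ≡ true → m < n
<ᵇ-true⇒< m n eq = ℕP.<ᵇ⇒< m n (true⇒T eq)

≥⇒<ᵇ-false : ∀ {m n} → n ≤ m → (m <ᵇ n) ≡ false
≥⇒<ᵇ-false {m} {n} n≤m with m <ᵇ n in eq
... | true  = ⊥-elim (ℕP.<⇒≱ (<ᵇ-true⇒< m n eq) n≤m)
... | false = refl

data Compareᵇ (m n : ℕ) : Set where
  less    : (m <ᵇ n) ≡ true  → (m ≡ᵇ n) ≡ false → (n <ᵇ m) ≡ false → Compareᵇ m n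
  equal   : (m <ᵇ n) ≡ false → (m ≡ᵇ n) ≡ true  → (n <ᵇ m) ≡ false → Compareᵇ m n
  greater : (m <ᵇ n) ≡ false → (m ≡ᵇ n) ≡ false → (n <ᵇ m) ≡ true  → Compareᵇ m n

compareᵇ : ∀ m n → Compareᵇ m n
compareᵇ m n with ℕP.<-cmp m n
... | tri< m<n m≢n _ = less (<⇒<ᵇ-true m<n) (≢⇒≡ᵇ-false m n m≢n) (≥⇒<ᵇ-false (ℕP.<⇒≤ m<n))
... | tri≈ _ refl _  = equal (≥⇒<ᵇ-false (ℕP.≤-refl {m})) (≡ᵇ-refl m) (≥⇒<ᵇ-false (ℕP.≤-refl {m}))
... | tri> _ m≢n n<m = greater (≥⇒<ᵇ-false (ℕP.<⇒≤ n<m)) (≢⇒≡ᵇ-false m n m≢n) (<⇒<ᵇ-true n<m)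

<ᵇ-asym : ∀ m n → ((m <ᵇ n) ∧ (n <ᵇ m)) ≡ false
<ᵇ-asym m n with compareᵇ m n
... | less    _   _ n≮m rewrite n≮m = 𝔹P.∧-zeroʳ (m <ᵇ n)
... | equal   m≮n _ _   rewrite m≮n = refl
... | greater m≮n _ _   rewrite m≮n = refl

∑ : {A : Set} → List A → (A → ℤ) → ℤ
∑ []       f = 0ℤ
∑ (x ∷ xs) f = f x + ∑ xs f

module _ {A : Set} where

  ∑-++ : ∀ (xs ys : List A) f → ∑ (xs ++ ys) f ≡ ∑ xs f + ∑ ys f
  ∑-++ []       ys f = sym (ℤP.+-identityˡ _)
  ∑-++ (x ∷ xs) ys f = trans (cong (_+_ (f x)) (∑-++ xs ys f)) (sym (ℤP.+-assoc (f x) _ _))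

  ∑-cong : ∀ (xs : List A) {f g} → (∀ x → f x ≡ g x) → ∑ xs f ≡ ∑ xs g
  ∑-cong []       eq = refl
  ∑-cong (x ∷ xs) eq = cong₂ _+_ (eq x) (∑-cong xs eq)

  ∑-zero : ∀ (xs : List A) → ∑ xs (λ _ → 0ℤ) ≡ 0ℤ
  ∑-zero []       = refl
  ∑-zero (x ∷ xs) = trans (ℤP.+-identityˡ _) (∑-zero xs)

  ∑-+ : ∀ (xs : List A) f g → ∑ xs (λ x → f x + g x) ≡ ∑ xs f + ∑ xs g
  ∑-+ []       f g = refl
  ∑-+ (x ∷ xs) f g =
    trans (cong (_+_ (f x + g x)) (∑-+ xs f g)) (+-interchange (f x) (g x) (∑ xs f) (∑ xs g))

  ∑-*ˡ : ∀ (xs : List A) c f → ∑ xs (λ x → c * f x) ≡ c * ∑ xs f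
  ∑-*ˡ []       c f = sym (ℤP.*-zeroʳ c)
  ∑-*ˡ (x ∷ xs) c f = trans (cong (_+_ (c * f x)) (∑-*ˡ xs c f)) (sym (ℤP.*-distribˡ-+ c (f x) _))

  length≡∑1 : ∀ (xs : List A) → + length xs ≡ ∑ xs (λ _ → 1ℤ)
  length≡∑1 []       = refl
  length≡∑1 (x ∷ xs) = cong (_+_ 1ℤ) (length≡∑1 xs)

  ∑-filter : ∀ {ℓ} {P : Pred A ℓ} (P? : Decidable P) xs f →
             ∑ (filter P? xs) f ≡ ∑ xs (λ x → 𝟙ℤ (does (P? x)) * f x)
  ∑-filter P? []       f = refl
  ∑-filter P? (x ∷ xs) f with P? x
  ... | yes _ = cong₂ _+_ (sym (ℤP.*-identityˡ (f x))) (∑-filter P? xs f)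
  ... | no  _ = trans (∑-filter P? xs f) (sym (ℤP.+-identityˡ _))

module _ {A B : Set} where

  ∑-map : ∀ (g : A → B) xs f → ∑ (map g xs) f ≡ ∑ xs (λ x → f (g x))
  ∑-map g []       f = refl
  ∑-map g (x ∷ xs) f = cong (_+_ (f (g x))) (∑-map g xs f)

  ∑-concatMap : ∀ (g : A → List B) xs f → ∑ (concatMap g xs) f ≡ ∑ xs (λ x → ∑ (g x) f)
  ∑-concatMap g []       f = refl
  ∑-concatMap g (x ∷ xs) f =
    trans (∑-++ (g x) (concatMap g xs) f) (cong (_+_ (∑ (g x) f)) (∑-concatMap g xs f))

  ∑-comm : ∀ (xs : List A) (ys : List B) (f : A → B → ℤ) →
           ∑ xs (λ x → ∑ ys (f x)) ≡ ∑ ys (λ y → ∑ xs (λ x → f x y))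
  ∑-comm []       ys f = sym (∑-zero ys)
  ∑-comm (x ∷ xs) ys f = trans (cong (_+_ (∑ ys (f x))) (∑-comm xs ys f)) (sym (∑-+ ys (f x) _))

range-suc : ∀ n → range (suc n) ≡ range n ++ suc n ∷ []
range-suc n = trans (cong (map suc) (sym (ListP.upTo-∷ʳ n))) (ListP.map-++ suc (upTo n) (n ∷ []))

∑₁ : ℕ → (ℕ → ℤ) → ℤ
∑₁ zero    f = 0ℤ
∑₁ (suc n) f = ∑₁ n f + f (suc n)

∑-range : ∀ n f → ∑ (range n) f ≡ ∑₁ n f
∑-range zero    f = refl
∑-range (suc n) f = begin
  ∑ (range (suc n)) f                 ≡⟨ cong (λ xs → ∑ xs f) (range-suc n) ⟩
  ∑ (range n ++ suc n ∷ []) f         ≡⟨ ∑-++ (range n) (suc n ∷ []) f ⟩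
  ∑ (range n) f + (f (suc n) + 0ℤ)    ≡⟨ cong₂ _+_ (∑-range n f) (ℤP.+-identityʳ (f (suc n))) ⟩
  ∑₁ n f + f (suc n)                  ∎
  where open ≡-Reasoning

∑₁-cong : ∀ n {f g} → (∀ k → k < n → f (suc k) ≡ g (suc k)) → ∑₁ n f ≡ ∑₁ n g
∑₁-cong zero    eq = refl
∑₁-cong (suc n) eq = cong₂ _+_ (∑₁-cong n (λ k k<n → eq k (ℕP.m<n⇒m<1+n k<n))) (eq n ℕP.≤-refl)

∑₁-zero : ∀ n → ∑₁ n (λ _ → 0ℤ) ≡ 0ℤ
∑₁-zero zero    = refl
∑₁-zero (suc n) = trans (ℤP.+-identityʳ _) (∑₁-zero n)

∑₁-+ : ∀ n f g → ∑₁ n (λ k → f k + g k) ≡ ∑₁ n f + ∑₁ n g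
∑₁-+ zero    f g = refl
∑₁-+ (suc n) f g = trans (cong (_+ (f (suc n) + g (suc n))) (∑₁-+ n f g))
                         (+-interchange (∑₁ n f) (∑₁ n g) (f (suc n)) (g (suc n)))

∑₁-point : ∀ n q (X : ℕ → ℤ) → 1 ≤ q → q ≤ n → ∑₁ n (λ k → if k ≡ᵇ q then X k else 0ℤ) ≡ X q
∑₁-point n       zero    X () _
∑₁-point zero    (suc q) X _  ()
∑₁-point (suc n) (suc q) X _  q≤n with ℕP.m≤n⇒m<n∨m≡n q≤n
... | inj₁ q<n
  rewrite ∑₁-point n (suc q) X (s≤s z≤n) (ℕP.≤-pred q<n)
        | ≢⇒≡ᵇ-false (suc n) (suc q) (ℕP.>⇒≢ q<n) = ℤP.+-identityʳ (X (suc q))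
... | inj₂ refl
  rewrite ≡ᵇ-refl q = trans (cong (_+ X (suc q)) (trans (∑₁-cong q below) (∑₁-zero q))) (ℤP.+-identityˡ _)
  where
  below : ∀ k → k < q → (if suc k ≡ᵇ suc q then X (suc k) else 0ℤ) ≡ 0ℤ
  below k k<q rewrite ≢⇒≡ᵇ-false k q (ℕP.<⇒≢ k<q) = refl

-- A subset of {1, …, n} is a predicate ℕ → Bool; only its values at 1, …, n matter.

card : ℕ → (ℕ → Bool) → ℕ
card zero    c = 0
card (suc n) c = card n c ℕ.+ 𝟙 (c (suc n))

∑₁-𝟙* : ∀ n (c : ℕ → Bool) X → ∑₁ n (λ k → 𝟙ℤ (c k) * X) ≡ + card n c * X
∑₁-𝟙* zero    c X = sym (ℤP.*-zeroˡ X)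
∑₁-𝟙* (suc n) c X = trans (cong (_+ 𝟙ℤ (c (suc n)) * X) (∑₁-𝟙* n c X))
                          (sym (ℤP.*-distribʳ-+ X (+ card n c) (𝟙ℤ (c (suc n)))))

∑₁-𝟙 : ∀ n (c : ℕ → Bool) → ∑₁ n (λ k → 𝟙ℤ (c k)) ≡ + card n c
∑₁-𝟙 n c = trans (∑₁-cong n (λ k _ → sym (ℤP.*-identityʳ (𝟙ℤ (c (suc k))))))
                 (trans (∑₁-𝟙* n c 1ℤ) (ℤP.*-identityʳ _))

card-cong : ∀ n {b b′} → (∀ k → k < n → b (suc k) ≡ b′ (suc k)) → card n b ≡ card n b′
card-cong zero    eq = refl
card-cong (suc n) eq = cong₂ ℕ._+_ (card-cong n (λ k k<n → eq k (ℕP.m<n⇒m<1+n k<n))) (cong 𝟙 (eq n ℕP.≤-refl))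

card-∅ : ∀ n → card n (λ _ → false) ≡ 0
card-∅ zero    = refl
card-∅ (suc n) = trans (ℕP.+-identityʳ _) (card-∅ n)

card≡0⇒∅ : ∀ n (c : ℕ → Bool) → card n c ≡ 0 → ∀ k → k < n → c (suc k) ≡ false
card≡0⇒∅ (suc n) c eq k k<1+n with c (suc n) in cn | ℕP.m≤n⇒m<n∨m≡n (ℕP.≤-pred k<1+n)
... | true  | _         = ⊥-elim (ℕP.1+n≢0 (trans (ℕP.+-comm 1 (card n c)) eq))
... | false | inj₁ k<n  = card≡0⇒∅ n c (trans (sym (ℕP.+-identityʳ _)) eq) k k<n
... | false | inj₂ refl = cn

card-full : ∀ n (c : ℕ → Bool) → (∀ k → k < n → c (suc k) ≡ true) → card n c ≡ n
card-full zero    c all = refl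
card-full (suc n) c all
  rewrite card-full n c (λ k k<n → all k (ℕP.m<n⇒m<1+n k<n)) | all n ℕP.≤-refl = ℕP.+-comm n 1

card-above : ∀ n q (c : ℕ → Bool) → card n (λ k → (q <ᵇ k) ∧ c k) ≤ n ∸ q
card-above zero    q c = z≤n
card-above (suc n) q c with q <ᵇ suc n in q<1+n
... | false = ℕP.≤-trans (ℕP.≤-reflexive (ℕP.+-identityʳ _))
                         (ℕP.≤-trans (card-above n q c) (ℕP.∸-monoˡ-≤ q (ℕP.n≤1+n n)))
... | true  = begin
  card n (λ k → (q <ᵇ k) ∧ c k) ℕ.+ 𝟙 (c (suc n)) ≤⟨ ℕP.+-mono-≤ (card-above n q c) (𝟙≤1 (c (suc n))) ⟩
  n ∸ q ℕ.+ 1                                     ≡⟨ ℕP.+-comm (n ∸ q) 1 ⟩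
  suc (n ∸ q)                                     ≡⟨ sym (ℕP.+-∸-assoc 1 (ℕP.≤-pred (<ᵇ-true⇒< q (suc n) q<1+n))) ⟩
  suc n ∸ q                                       ∎
  where
  open ℕP.≤-Reasoning
  𝟙≤1 : ∀ b → 𝟙 b ≤ 1
  𝟙≤1 true  = ℕP.≤-refl
  𝟙≤1 false = z≤n

card-below : ∀ n u → u ≤ suc n → card n (_<ᵇ u) ≡ u ∸ 1
card-below zero    zero          _ = refl
card-below zero    (suc zero)    _ = refl
card-below zero    (suc (suc u)) (s≤s ())
card-below (suc n) u u≤2+n with ℕP.m≤n⇒m<n∨m≡n u≤2+n
... | inj₂ refl  = card-full (suc n) _ (λ k k<1+n → <⇒<ᵇ-true (s≤s k<1+n))
... | inj₁ u<2+n rewrite ≥⇒<ᵇ-false (ℕP.≤-pred u<2+n) = trans (ℕP.+-identityʳ _) (card-below n u (ℕP.≤-pred u<2+n))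

∑₁-trichotomy : ∀ n q (b : ℕ → Bool) x y z → 1 ≤ q → q ≤ n →
  ∑₁ n (λ v → 𝟙ℤ (b v ∧ (v <ᵇ q)) * x + (if v ≡ᵇ q then 𝟙ℤ (b v) * y else 0ℤ) + 𝟙ℤ ((q <ᵇ v) ∧ b v) * z)
    ≡ + card n (λ v → b v ∧ (v <ᵇ q)) * x + 𝟙ℤ (b q) * y + + card n (λ v → (q <ᵇ v) ∧ b v) * z
∑₁-trichotomy n q b x y z 1≤q q≤n = begin
  ∑₁ n (λ v → L v + E v + G v)          ≡⟨ ∑₁-+ n (λ v → L v + E v) G ⟩
  ∑₁ n (λ v → L v + E v) + ∑₁ n G      ≡⟨ cong (_+ ∑₁ n G) (∑₁-+ n L E) ⟩
  ∑₁ n L + ∑₁ n E + ∑₁ n G             ≡⟨ cong₂ (λ l e → l + e + ∑₁ n G) (∑₁-𝟙* n _ x)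
                                                 (∑₁-point n q (λ v → 𝟙ℤ (b v) * y) 1≤q q≤n) ⟩
  + card n (λ v → b v ∧ (v <ᵇ q)) * x + 𝟙ℤ (b q) * y + ∑₁ n G
                                        ≡⟨ cong (λ g → + card n (λ v → b v ∧ (v <ᵇ q)) * x + 𝟙ℤ (b q) * y + g) (∑₁-𝟙* n _ z) ⟩
  + card n (λ v → b v ∧ (v <ᵇ q)) * x + 𝟙ℤ (b q) * y + + card n (λ v → (q <ᵇ v) ∧ b v) * z ∎
  where
  open ≡-Reasoning
  L E G : ℕ → ℤ
  L v = 𝟙ℤ (b v ∧ (v <ᵇ q)) * x
  E v = if v ≡ᵇ q then 𝟙ℤ (b v) * y else 0ℤ
  G v = 𝟙ℤ ((q <ᵇ v) ∧ b v) * z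

card-trichotomy : ∀ n q (b : ℕ → Bool) → 1 ≤ q → q ≤ n →
  card n b ≡ card n (λ v → b v ∧ (v <ᵇ q)) ℕ.+ 𝟙 (b q) ℕ.+ card n (λ v → (q <ᵇ v) ∧ b v)
card-trichotomy n q b 1≤q q≤n = ℤP.+-injective (begin
  + card n b                     ≡⟨ sym (∑₁-𝟙 n b) ⟩
  ∑₁ n (λ v → 𝟙ℤ (b v))         ≡⟨ ∑₁-cong n (λ k _ → split (b (suc k)) (suc k)) ⟩
  ∑₁ n _                         ≡⟨ ∑₁-trichotomy n q b 1ℤ 1ℤ 1ℤ 1≤q q≤n ⟩
  + N * 1ℤ + 𝟙ℤ (b q) * 1ℤ + + K * 1ℤ ≡⟨ unit (+ N) (𝟙ℤ (b q)) (+ K) ⟩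
  + N + 𝟙ℤ (b q) + + K           ∎)
  where
  open ≡-Reasoning
  N = card n (λ v → b v ∧ (v <ᵇ q))
  K = card n (λ v → (q <ᵇ v) ∧ b v)
  unit : ∀ a b c → a * 1ℤ + b * 1ℤ + c * 1ℤ ≡ a + b + c
  unit = solve-∀
  split : ∀ bv v → 𝟙ℤ bv ≡ 𝟙ℤ (bv ∧ (v <ᵇ q)) * 1ℤ + (if v ≡ᵇ q then 𝟙ℤ bv * 1ℤ else 0ℤ) + 𝟙ℤ ((q <ᵇ v) ∧ bv) * 1ℤ
  split false v rewrite 𝔹P.∧-zeroʳ (q <ᵇ v) with v ≡ᵇ q
  ... | true  = refl
  ... | false = refl
  split true  v with compareᵇ v q
  ... | less    v<q v≢q q≮v rewrite v<q | v≢q | q≮v = refl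
  ... | equal   v≮q v≡q q≮v rewrite v≮q | v≡q | q≮v = refl
  ... | greater v≮q v≢q q<v rewrite v≮q | v≢q | q<v = refl

remove : (ℕ → Bool) → ℕ → (ℕ → Bool)
remove c v k = c k ∧ not (k ≡ᵇ v)

card-remove : ∀ n (c : ℕ → Bool) v → 1 ≤ v → v ≤ n → c v ≡ true → card n (remove c v) ℕ.+ 1 ≡ card n c
card-remove n       c zero    () _ _
card-remove zero    c (suc v) _  () _
card-remove (suc n) c (suc v) _  v≤n cv with ℕP.m≤n⇒m<n∨m≡n v≤n
... | inj₁ v<n
  rewrite ≢⇒≡ᵇ-false (suc n) (suc v) (ℕP.>⇒≢ v<n) | 𝔹P.∧-identityʳ (c (suc n)) =
    trans (swap (card n (remove c (suc v))) (𝟙 (c (suc n))))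
          (cong (ℕ._+ 𝟙 (c (suc n))) (card-remove n c (suc v) (s≤s z≤n) (ℕP.≤-pred v<n) cv))
  where
  swap : ∀ a b → a ℕ.+ b ℕ.+ 1 ≡ a ℕ.+ 1 ℕ.+ b
  swap = ℕ-solve-∀
... | inj₂ refl
  rewrite ≡ᵇ-refl v | 𝔹P.∧-zeroʳ (c (suc v)) | cv = cong (ℕ._+ 1) (trans (ℕP.+-identityʳ _) (card-cong v below))
  where
  below : ∀ k → k < v → remove c (suc v) (suc k) ≡ c (suc k)
  below k k<v rewrite ≢⇒≡ᵇ-false k v (ℕP.<⇒≢ k<v) = 𝔹P.∧-identityʳ (c (suc k))

remove-least : ∀ p k → remove (p <ᵇ_) (suc p) k ≡ (suc p <ᵇ k)
remove-least p k with compareᵇ k (suc p)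
... | less    k<q k≢q q≮k rewrite k≢q | q≮k | ≥⇒<ᵇ-false (ℕP.≤-pred (<ᵇ-true⇒< k (suc p) k<q)) = refl
... | equal   _   k≡q _   rewrite ≡ᵇ⇒≡ k (suc p) k≡q | ≡ᵇ-refl p | ≥⇒<ᵇ-false (ℕP.≤-refl {p}) = 𝔹P.∧-zeroʳ _
... | greater _   k≢q q<k rewrite k≢q | q<k
                          | <⇒<ᵇ-true (ℕP.<-trans (ℕP.n<1+n p) (<ᵇ-true⇒< (suc p) k q<k)) = refl

all₁ : ℕ → (ℕ → Bool) → Bool
all₁ zero    f = true
all₁ (suc n) f = all₁ n f ∧ f (suc n)

all-++ : ∀ {A : Set} (f : A → Bool) xs ys → all f (xs ++ ys) ≡ all f xs ∧ all f ys
all-++ f []       ys = refl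
all-++ f (x ∷ xs) ys = trans (cong (f x ∧_) (all-++ f xs ys)) (sym (𝔹P.∧-assoc (f x) _ _))

all-range : ∀ n f → all f (range n) ≡ all₁ n f
all-range zero    f = refl
all-range (suc n) f = begin
  all f (range (suc n))             ≡⟨ cong (all f) (range-suc n) ⟩
  all f (range n ++ suc n ∷ [])     ≡⟨ all-++ f (range n) (suc n ∷ []) ⟩
  all f (range n) ∧ (f (suc n) ∧ true) ≡⟨ cong₂ _∧_ (all-range n f) (𝔹P.∧-identityʳ (f (suc n))) ⟩
  all₁ n f ∧ f (suc n)              ∎
  where open ≡-Reasoning

all₁-cong : ∀ n {f g} → (∀ k → k < n → f (suc k) ≡ g (suc k)) → all₁ n f ≡ all₁ n g
all₁-cong zero    eq = refl
all₁-cong (suc n) eq = cong₂ _∧_ (all₁-cong n (λ k k<n → eq k (ℕP.m<n⇒m<1+n k<n))) (eq n ℕP.≤-refl)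

all₁-const : ∀ n → all₁ n (λ _ → true) ≡ true
all₁-const zero    = refl
all₁-const (suc n) = cong (_∧ true) (all₁-const n)

all₁-false : ∀ n f v → 1 ≤ v → v ≤ n → f v ≡ false → all₁ n f ≡ false
all₁-false n       f zero    () _ _
all₁-false zero    f (suc v) _  () _
all₁-false (suc n) f (suc v) _  v≤n fv with ℕP.m≤n⇒m<n∨m≡n v≤n
... | inj₁ v<n  = cong (_∧ f (suc n)) (all₁-false n f (suc v) (s≤s z≤n) (ℕP.≤-pred v<n) fv)
... | inj₂ refl = trans (cong (all₁ v f ∧_) fv) (𝔹P.∧-zeroʳ (all₁ v f))

all₁-true : ∀ n f → all₁ n f ≡ true → ∀ v → 1 ≤ v → v ≤ n → f v ≡ true
all₁-true n f all v 1≤v v≤n with f v in fv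
... | true  = refl
... | false = trans (sym (all₁-false n f v 1≤v v≤n fv)) all

Letter : ℕ → ℤ → Set
Letter n a = 1 ≤ ∣ a ∣ × ∣ a ∣ ≤ n

∑-words : ∀ (A : List ℤ) m f → ∑ (words A (suc m)) f ≡ ∑ A (λ a → ∑ (words A m) (λ w → f (a ∷ w)))
∑-words A m f = begin
  ∑ (concatMap (λ w → map (_∷ w) A) (words A m)) f  ≡⟨ ∑-concatMap (λ w → map (_∷ w) A) (words A m) f ⟩
  ∑ (words A m) (λ w → ∑ (map (_∷ w) A) f)          ≡⟨ ∑-cong (words A m) (λ w → ∑-map (_∷ w) A f) ⟩
  ∑ (words A m) (λ w → ∑ A (λ a → f (a ∷ w)))      ≡⟨ ∑-comm (words A m) A (λ w a → f (a ∷ w)) ⟩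
  ∑ A (λ a → ∑ (words A m) (λ w → f (a ∷ w)))      ∎
  where open ≡-Reasoning

∑-letters : ∀ n g → ∑ (letters n) g ≡ ∑₁ n (λ v → g (+ v) + g (- + v))
∑-letters n g = begin
  ∑ (map +_ (range n) ++ map (λ k → - + k) (range n)) g
    ≡⟨ ∑-++ (map +_ (range n)) _ g ⟩
  ∑ (map +_ (range n)) g + ∑ (map (λ k → - + k) (range n)) g
    ≡⟨ cong₂ _+_ (trans (∑-map +_ (range n) g) (∑-range n _))
                 (trans (∑-map (λ k → - + k) (range n) g) (∑-range n _)) ⟩
  ∑₁ n (λ v → g (+ v)) + ∑₁ n (λ v → g (- + v))
    ≡⟨ sym (∑₁-+ n _ _) ⟩
  ∑₁ n (λ v → g (+ v) + g (- + v)) ∎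
  where open ≡-Reasoning

∑-words-cong : ∀ n m {f g} → (∀ w → All (Letter n) w → f w ≡ g w) →
               ∑ (words (letters n) m) f ≡ ∑ (words (letters n) m) g
∑-words-cong n zero    eq = cong (_+ 0ℤ) (eq [] [])
∑-words-cong n (suc m) {f} {g} eq = begin
  ∑ (words (letters n) (suc m)) f                                   ≡⟨ ∑-words (letters n) m f ⟩
  ∑ (letters n) (λ a → ∑ (words (letters n) m) (λ w → f (a ∷ w)))  ≡⟨ ∑-letters n _ ⟩
  ∑₁ n (λ v → tail f (+ v) + tail f (- + v))                        ≡⟨ ∑₁-cong n (λ k k<n →
                                                                         cong₂ _+_ (tails (+ suc k) (s≤s z≤n , k<n))
                                                                                   (tails (- + suc k) (s≤s z≤n , k<n))) ⟩
  ∑₁ n (λ v → tail g (+ v) + tail g (- + v))                        ≡⟨ sym (∑-letters n _) ⟩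
  ∑ (letters n) (λ a → ∑ (words (letters n) m) (λ w → g (a ∷ w)))  ≡⟨ sym (∑-words (letters n) m g) ⟩
  ∑ (words (letters n) (suc m)) g                                   ∎
  where
  open ≡-Reasoning
  tail : (List ℤ → ℤ) → ℤ → ℤ
  tail h a = ∑ (words (letters n) m) (λ w → h (a ∷ w))
  tails : ∀ a → Letter n a → tail f a ≡ tail g a
  tails a a∈ = ∑-words-cong n m (λ w w∈ → eq (a ∷ w) (a∈ ∷ w∈))

arranges : ℕ → (ℕ → Bool) → List ℤ → Bool
arranges n c w = all₁ n (λ k → count k (map ∣_∣ w) ≡ᵇ 𝟙 (c k))

isSignedPerm≡arranges : ∀ n σ → isSignedPerm n σ ≡ arranges n (λ _ → true) σ
isSignedPerm≡arranges n σ = all-range n _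

arranges-cong : ∀ n {c c′} w → (∀ k → k < n → c (suc k) ≡ c′ (suc k)) → arranges n c w ≡ arranges n c′ w
arranges-cong n w eq = all₁-cong n (λ k k<n → cong (λ b → count (suc k) (map ∣_∣ w) ≡ᵇ 𝟙 b) (eq k k<n))

arranges-∷ : ∀ n c a w → Letter n a → arranges n c (a ∷ w) ≡ c ∣ a ∣ ∧ arranges n (remove c ∣ a ∣) w
arranges-∷ n c a w (1≤a , a≤n) with c ∣ a ∣ in ca
... | true  = all₁-cong n same
  where
  same : ∀ k → k < n → (count (suc k) (map ∣_∣ (a ∷ w)) ≡ᵇ 𝟙 (c (suc k)))
                     ≡ (count (suc k) (map ∣_∣ w) ≡ᵇ 𝟙 (remove c ∣ a ∣ (suc k)))
  same k _ with suc k ≡ᵇ ∣ a ∣ in k≡a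
  ... | true  rewrite sym (≡ᵇ⇒≡ (suc k) ∣ a ∣ k≡a) | ca = refl
  ... | false rewrite 𝔹P.∧-identityʳ (c (suc k)) = refl
... | false = all₁-false n _ ∣ a ∣ 1≤a a≤n mismatch
  where
  mismatch : ((if ∣ a ∣ ≡ᵇ ∣ a ∣ then suc (count ∣ a ∣ (map ∣_∣ w)) else count ∣ a ∣ (map ∣_∣ w)) ≡ᵇ 𝟙 (c ∣ a ∣)) ≡ false
  mismatch rewrite ≡ᵇ-refl ∣ a ∣ | ca = refl

arranges-count : ∀ n c w → arranges n c w ≡ true → ∀ k → 1 ≤ k → k ≤ n → count k (map ∣_∣ w) ≡ 𝟙 (c k)
arranges-count n c w arr k 1≤k k≤n = ≡ᵇ⇒≡ _ _ (all₁-true n _ arr k 1≤k k≤n)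

arranges-∅ : ∀ n c → card n c ≡ 0 → arranges n c [] ≡ true
arranges-∅ n c empty = trans (all₁-cong n (λ k k<n → cong (λ b → 0 ≡ᵇ 𝟙 b) (card≡0⇒∅ n c empty k k<n)))
                             (all₁-const n)

derangedFrom : ℕ → List ℤ → Bool
derangedFrom p []      = true
derangedFrom p (a ∷ w) = not (does (a ℤ.≟ + suc p)) ∧ derangedFrom (suc p) w

isDerangement≡derangedFrom : ∀ σ → isDerangement σ ≡ derangedFrom 0 σ
isDerangement≡derangedFrom σ = shifted (λ x → x) 0 σ (λ _ → refl)
  where
  shifted : ∀ (f : ℕ → ℕ) p w → (∀ x → f x ≡ p ℕ.+ x) →
            all (λ q → not (does (proj₂ q ℤ.≟ + proj₁ q))) (zip (map suc (applyUpTo f (length w))) w)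
              ≡ derangedFrom p w
  shifted f p []      f≗p+ = refl
  shifted f p (a ∷ w) f≗p+ rewrite f≗p+ 0 | ℕP.+-identityʳ p =
    cong (not (does (a ℤ.≟ + suc p)) ∧_)
         (shifted (λ x → f (suc x)) (suc p) w (λ x → trans (f≗p+ (suc x)) (ℕP.+-suc p x)))

countBelow : ℕ → List ℤ → ℕ
countBelow u []      = 0
countBelow u (y ∷ w) = 𝟙 (∣ y ∣ <ᵇ u) ℕ.+ countBelow u w

countBelow≡∑ : ∀ n u w → All (Letter n) w →
               + countBelow u w ≡ ∑₁ n (λ k → if k <ᵇ u then + count k (map ∣_∣ w) else 0ℤ)
countBelow≡∑ n u []      []       = sym (trans (∑₁-cong n (λ k _ → if-same (suc k <ᵇ u))) (∑₁-zero n))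
  where
  if-same : ∀ b → (if b then 0ℤ else 0ℤ) ≡ 0ℤ
  if-same true  = refl
  if-same false = refl
countBelow≡∑ n u (y ∷ w) (y∈ ∷ w∈) = begin
  + 𝟙 (∣ y ∣ <ᵇ u) + + countBelow u w
    ≡⟨ cong₂ _+_ (sym (∑₁-point n ∣ y ∣ (λ _ → 𝟙ℤ (∣ y ∣ <ᵇ u)) (proj₁ y∈) (proj₂ y∈))) (countBelow≡∑ n u w w∈) ⟩
  ∑₁ n (λ k → if k ≡ᵇ ∣ y ∣ then 𝟙ℤ (∣ y ∣ <ᵇ u) else 0ℤ) + ∑₁ n (λ k → if k <ᵇ u then + count k (map ∣_∣ w) else 0ℤ)
    ≡⟨ sym (∑₁-+ n _ _) ⟩
  ∑₁ n (λ k → (if k ≡ᵇ ∣ y ∣ then 𝟙ℤ (∣ y ∣ <ᵇ u) else 0ℤ) + (if k <ᵇ u then + count k (map ∣_∣ w) else 0ℤ))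
    ≡⟨ ∑₁-cong n (λ k _ → sym (split (suc k) (count (suc k) (map ∣_∣ w)))) ⟩
  ∑₁ n (λ k → if k <ᵇ u then + count k (map ∣_∣ (y ∷ w)) else 0ℤ) ∎
  where
  open ≡-Reasoning
  split : ∀ k c → (if k <ᵇ u then + (if k ≡ᵇ ∣ y ∣ then suc c else c) else 0ℤ)
                ≡ (if k ≡ᵇ ∣ y ∣ then 𝟙ℤ (∣ y ∣ <ᵇ u) else 0ℤ) + (if k <ᵇ u then + c else 0ℤ)
  split k c with k ≡ᵇ ∣ y ∣ in k≡y
  ... | true rewrite ≡ᵇ⇒≡ k ∣ y ∣ k≡y with ∣ y ∣ <ᵇ u
  ...   | true  = refl
  ...   | false = refl
  split k c | false with k <ᵇ u
  ...   | true  = refl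
  ...   | false = refl

countBelow-arranges : ∀ n c u w → All (Letter n) w → arranges n c w ≡ true →
                      countBelow u w ≡ card n (λ k → (k <ᵇ u) ∧ c k)
countBelow-arranges n c u w w∈ arr = ℤP.+-injective (begin
  + countBelow u w                                                    ≡⟨ countBelow≡∑ n u w w∈ ⟩
  ∑₁ n (λ k → if k <ᵇ u then + count k (map ∣_∣ w) else 0ℤ)         ≡⟨ ∑₁-cong n counted ⟩
  ∑₁ n (λ k → 𝟙ℤ ((k <ᵇ u) ∧ c k))                                  ≡⟨ ∑₁-𝟙 n _ ⟩
  + card n (λ k → (k <ᵇ u) ∧ c k)                                     ∎)
  where
  open ≡-Reasoning
  counted : ∀ k → k < n → (if suc k <ᵇ u then + count (suc k) (map ∣_∣ w) else 0ℤ) ≡ 𝟙ℤ ((suc k <ᵇ u) ∧ c (suc k))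
  counted k k<n with suc k <ᵇ u
  ... | true  = cong +_ (arranges-count n c w arr (suc k) (s≤s z≤n) k<n)
  ... | false = refl

-- Parity of the Coxeter length

sgn-+ : ∀ a b → sgn (a ℕ.+ b) ≡ sgn a * sgn b
sgn-+ = ℤP.^-distribˡ-+-* (- + 1)

isNeg : ℤ → Bool
isNeg x = does (x ℤ.<? + 0)

negCount : List ℤ → ℕ
negCount []      = 0
negCount (x ∷ w) = 𝟙 (isNeg x) ℕ.+ negCount w

absInv : List ℤ → ℕ
absInv []      = 0
absInv (x ∷ w) = countBelow ∣ x ∣ w ℕ.+ absInv w

lessCount : ℤ → List ℤ → ℕ
lessCount x w = length (filter (ℤ._<? x) w)

lessCount-∷ : ∀ x y w → lessCount x (y ∷ w) ≡ 𝟙 (does (y ℤ.<? x)) ℕ.+ lessCount x w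
lessCount-∷ x y w with does (y ℤ.<? x)
... | true  = refl
... | false = refl

crossNeg : ℤ → List ℤ → ℕ
crossNeg x []      = 0
crossNeg x (y ∷ w) = 𝟙 (isNeg x ∧ (∣ y ∣ <ᵇ ∣ x ∣)) ℕ.+ 𝟙 (isNeg y ∧ (∣ x ∣ <ᵇ ∣ y ∣)) ℕ.+ crossNeg x w

sgn-pair : ∀ x y → 1 ≤ ∣ x ∣ → 1 ≤ ∣ y ∣ → (∣ x ∣ ≡ᵇ ∣ y ∣) ≡ false →
  sgn (𝟙 (does (y ℤ.<? x))) * sgn (𝟙 (isNeg x ∧ (∣ y ∣ <ᵇ ∣ x ∣)) ℕ.+ 𝟙 (isNeg y ∧ (∣ x ∣ <ᵇ ∣ y ∣)))
    ≡ sgn (𝟙 (∣ y ∣ <ᵇ ∣ x ∣))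
sgn-pair (+ zero) y () _ _
sgn-pair x (+ zero) _ () _
sgn-pair (+ suc a) (+ suc b) _ _ a≢b with compareᵇ a b
... | less    _ _ b≮a rewrite b≮a = refl
... | equal   _ a≡b _ rewrite a≡b with a≢b
...   | ()
sgn-pair (+ suc a) (+ suc b) _ _ a≢b | greater _ _ b<a rewrite b<a = refl
sgn-pair (+ suc a) -[1+ b ] _ _ a≢b with compareᵇ a b
... | less    a<b _ b≮a rewrite a<b | b≮a = refl
... | equal   _ a≡b _ rewrite a≡b with a≢b
...   | ()
sgn-pair (+ suc a) -[1+ b ] _ _ a≢b | greater a≮b _ b<a rewrite a≮b | b<a = refl
sgn-pair -[1+ a ] (+ suc b) _ _ a≢b with compareᵇ a b
... | less    _ _ b≮a rewrite b≮a = refl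
... | equal   _ a≡b _ rewrite a≡b with a≢b
...   | ()
sgn-pair -[1+ a ] (+ suc b) _ _ a≢b | greater _ _ b<a rewrite b<a = refl
sgn-pair -[1+ a ] -[1+ b ] _ _ a≢b with compareᵇ a b
... | less    a<b _ b≮a rewrite a<b | b≮a = refl
... | equal   _ a≡b _ rewrite a≡b with a≢b
...   | ()
sgn-pair -[1+ a ] -[1+ b ] _ _ a≢b | greater a≮b _ b<a rewrite a≮b | b<a = refl

sgn-lessCount*crossNeg : ∀ n x w → 1 ≤ ∣ x ∣ → All (Letter n) w → count ∣ x ∣ (map ∣_∣ w) ≡ 0 →
                         sgn (lessCount x w) * sgn (crossNeg x w) ≡ sgn (countBelow ∣ x ∣ w)
sgn-lessCount*crossNeg n x []      _   _          _  = refl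
sgn-lessCount*crossNeg n x (y ∷ w) 1≤x (y∈ ∷ w∈) x∉ with ∣ x ∣ ≡ᵇ ∣ y ∣ in x≡y
... | true  = ⊥-elim (ℕP.1+n≢0 x∉)
... | false = begin
  sgn (lessCount x (y ∷ w)) * sgn (crossNeg x (y ∷ w))
    ≡⟨ cong₂ _*_ (trans (cong sgn (lessCount-∷ x y w)) (sgn-+ t₁ (lessCount x w))) (sgn-+ t₂ (crossNeg x w)) ⟩
  (sgn t₁ * sgn (lessCount x w)) * (sgn t₂ * sgn (crossNeg x w))
    ≡⟨ *-interchange (sgn t₁) (sgn (lessCount x w)) (sgn t₂) (sgn (crossNeg x w)) ⟩
  (sgn t₁ * sgn t₂) * (sgn (lessCount x w) * sgn (crossNeg x w))
    ≡⟨ cong₂ _*_ (sgn-pair x y 1≤x (proj₁ y∈) x≡y) (sgn-lessCount*crossNeg n x w 1≤x w∈ x∉) ⟩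
  sgn (𝟙 (∣ y ∣ <ᵇ ∣ x ∣)) * sgn (countBelow ∣ x ∣ w)
    ≡⟨ sym (sgn-+ (𝟙 (∣ y ∣ <ᵇ ∣ x ∣)) (countBelow ∣ x ∣ w)) ⟩
  sgn (countBelow ∣ x ∣ (y ∷ w)) ∎
  where
  open ≡-Reasoning
  t₁ = 𝟙 (does (y ℤ.<? x))
  t₂ = 𝟙 (isNeg x ∧ (∣ y ∣ <ᵇ ∣ x ∣)) ℕ.+ 𝟙 (isNeg y ∧ (∣ x ∣ <ᵇ ∣ y ∣))

crossNegTotal : List ℤ → ℕ
crossNegTotal []      = 0
crossNegTotal (x ∷ w) = crossNeg x w ℕ.+ crossNegTotal w

sgn-inv*crossNegTotal : ∀ n c σ → All (Letter n) σ → arranges n c σ ≡ true →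
                        sgn (inv σ) * sgn (crossNegTotal σ) ≡ sgn (absInv σ)
sgn-inv*crossNegTotal n c []      _           _   = refl
sgn-inv*crossNegTotal n c (x ∷ w) (x∈ ∷ w∈) arr = begin
  sgn (lessCount x w ℕ.+ inv w) * sgn (crossNeg x w ℕ.+ crossNegTotal w)
    ≡⟨ cong₂ _*_ (sgn-+ (lessCount x w) (inv w)) (sgn-+ (crossNeg x w) (crossNegTotal w)) ⟩
  sgn (lessCount x w) * sgn (inv w) * (sgn (crossNeg x w) * sgn (crossNegTotal w))
    ≡⟨ *-interchange (sgn (lessCount x w)) (sgn (inv w)) (sgn (crossNeg x w)) (sgn (crossNegTotal w)) ⟩
  sgn (lessCount x w) * sgn (crossNeg x w) * (sgn (inv w) * sgn (crossNegTotal w))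
    ≡⟨ cong₂ _*_ (sgn-lessCount*crossNeg n x w (proj₁ x∈) w∈ x∉)
                 (sgn-inv*crossNegTotal n (remove c ∣ x ∣) w w∈ arr′) ⟩
  sgn (countBelow ∣ x ∣ w) * sgn (absInv w)
    ≡⟨ sym (sgn-+ (countBelow ∣ x ∣ w) (absInv w)) ⟩
  sgn (absInv (x ∷ w)) ∎
  where
  open ≡-Reasoning
  arr′ : arranges n (remove c ∣ x ∣) w ≡ true
  arr′ = 𝔹P.∧-conicalʳ _ _ (trans (sym (arranges-∷ n c x w x∈)) arr)
  x∉ : count ∣ x ∣ (map ∣_∣ w) ≡ 0
  x∉ = trans (arranges-count n (remove c ∣ x ∣) w arr′ ∣ x ∣ (proj₁ x∈) (proj₂ x∈))
             (cong 𝟙 (trans (cong (λ b → c ∣ x ∣ ∧ not b) (≡ᵇ-refl ∣ x ∣)) (𝔹P.∧-zeroʳ (c ∣ x ∣))))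

negBelow : List ℤ → List ℤ → ℕ
negBelow []      τ = 0
negBelow (e ∷ w) τ = 𝟙 (isNeg e) ℕ.* countBelow ∣ e ∣ τ ℕ.+ negBelow w τ

negAbove : ℤ → List ℤ → ℕ
negAbove x []      = 0
negAbove x (e ∷ w) = 𝟙 (isNeg e ∧ (∣ x ∣ <ᵇ ∣ e ∣)) ℕ.+ negAbove x w

negBelow-∷ : ∀ x w τ → negBelow w (x ∷ τ) ≡ negAbove x w ℕ.+ negBelow w τ
negBelow-∷ x []      τ = refl
negBelow-∷ x (e ∷ w) τ
  rewrite negBelow-∷ x w τ
        | ℕP.*-distribˡ-+ (𝟙 (isNeg e)) (𝟙 (∣ x ∣ <ᵇ ∣ e ∣)) (countBelow ∣ e ∣ τ)
        | 𝟙-∧ (isNeg e) (∣ x ∣ <ᵇ ∣ e ∣)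
  = ℕ-+-interchange (𝟙 (isNeg e ∧ (∣ x ∣ <ᵇ ∣ e ∣))) (𝟙 (isNeg e) ℕ.* countBelow ∣ e ∣ τ) (negAbove x w) (negBelow w τ)

crossNeg≡ : ∀ x w → crossNeg x w ≡ 𝟙 (isNeg x) ℕ.* countBelow ∣ x ∣ w ℕ.+ negAbove x w
crossNeg≡ x []      = cong (ℕ._+ 0) (sym (ℕP.*-zeroʳ (𝟙 (isNeg x))))
crossNeg≡ x (y ∷ w)
  rewrite crossNeg≡ x w
        | ℕP.*-distribˡ-+ (𝟙 (isNeg x)) (𝟙 (∣ y ∣ <ᵇ ∣ x ∣)) (countBelow ∣ x ∣ w)
        | 𝟙-∧ (isNeg x) (∣ y ∣ <ᵇ ∣ x ∣)
  = ℕ-+-interchange (𝟙 (isNeg x ∧ (∣ y ∣ <ᵇ ∣ x ∣))) (𝟙 (isNeg y ∧ (∣ x ∣ <ᵇ ∣ y ∣)))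
                    (𝟙 (isNeg x) ℕ.* countBelow ∣ x ∣ w) (negAbove x w)

crossNegTotal≡negBelow : ∀ σ → crossNegTotal σ ≡ negBelow σ σ
crossNegTotal≡negBelow []      = refl
crossNegTotal≡negBelow (x ∷ w)
  rewrite crossNegTotal≡negBelow w | negBelow-∷ x w w | crossNeg≡ x w | ≥⇒<ᵇ-false (ℕP.≤-refl {∣ x ∣})
  = ℕP.+-assoc (𝟙 (isNeg x) ℕ.* countBelow ∣ x ∣ w) (negAbove x w) (negBelow w w)

negSum≡negBelow+negCount : ∀ n w τ → All (Letter n) w → (∀ u → u ≤ n → countBelow u τ ≡ u ∸ 1) →
                           negSum w ≡ negBelow w τ ℕ.+ negCount w
negSum≡negBelow+negCount n []      τ []          below = refl
negSum≡negBelow+negCount n (x ∷ w) τ (x∈ ∷ w∈) below with x ℤ.<? + 0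
... | no  _ = negSum≡negBelow+negCount n w τ w∈ below
... | yes _ rewrite below ∣ x ∣ (proj₂ x∈) | negSum≡negBelow+negCount n w τ w∈ below
  = shift ∣ x ∣ (proj₁ x∈)
  where
  shift : ∀ a → 1 ≤ a → a ℕ.+ (negBelow w τ ℕ.+ negCount w) ≡ (a ∸ 1 ℕ.+ 0) ℕ.+ negBelow w τ ℕ.+ suc (negCount w)
  shift (suc a) _ = shifted a (negBelow w τ) (negCount w)
    where
    shifted : ∀ a b c → suc a ℕ.+ (b ℕ.+ c) ≡ a ℕ.+ 0 ℕ.+ b ℕ.+ suc c
    shifted = ℕ-solve-∀

countBelow-full : ∀ n σ → All (Letter n) σ → arranges n (λ _ → true) σ ≡ true →
                  ∀ u → u ≤ n → countBelow u σ ≡ u ∸ 1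
countBelow-full n σ σ∈ arr u u≤n =
  trans (countBelow-arranges n _ u σ σ∈ arr)
        (trans (card-cong n (λ k _ → 𝔹P.∧-identityʳ _)) (card-below n u (ℕP.m≤n⇒m≤1+n u≤n)))

sgn-ℓB : ∀ n σ → All (Letter n) σ → arranges n (λ _ → true) σ ≡ true →
         sgn (ℓB σ) ≡ sgn (absInv σ ℕ.+ negCount σ)
sgn-ℓB n σ σ∈ arr = begin
  sgn (inv σ ℕ.+ negSum σ)                           ≡⟨ sgn-+ (inv σ) (negSum σ) ⟩
  sgn (inv σ) * sgn (negSum σ)                       ≡⟨ cong (λ m → sgn (inv σ) * sgn m) negSum≡ ⟩
  sgn (inv σ) * sgn (crossNegTotal σ ℕ.+ negCount σ)  ≡⟨ cong (sgn (inv σ) *_) (sgn-+ (crossNegTotal σ) (negCount σ)) ⟩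
  sgn (inv σ) * (sgn (crossNegTotal σ) * sgn (negCount σ))
    ≡⟨ sym (ℤP.*-assoc (sgn (inv σ)) (sgn (crossNegTotal σ)) (sgn (negCount σ))) ⟩
  sgn (inv σ) * sgn (crossNegTotal σ) * sgn (negCount σ)
    ≡⟨ cong (_* sgn (negCount σ)) (sgn-inv*crossNegTotal n _ σ σ∈ arr) ⟩
  sgn (absInv σ) * sgn (negCount σ)                  ≡⟨ sym (sgn-+ (absInv σ) (negCount σ)) ⟩
  sgn (absInv σ ℕ.+ negCount σ)                      ∎
  where
  open ≡-Reasoning
  negSum≡ : negSum σ ≡ crossNegTotal σ ℕ.+ negCount σ
  negSum≡ = trans (negSum≡negBelow+negCount n σ σ σ∈ (countBelow-full n σ σ∈ arr))
                  (cong (ℕ._+ negCount σ) (sym (crossNegTotal≡negBelow σ)))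

-- A partial derangement fills positions p + 1, …, p + m with the values of c, each once and with either sign, and
-- has no fixed point.
derangedSum : ℕ → (ℕ → Bool) → ℕ → ℕ → (List ℤ → ℤ) → ℤ
derangedSum n c p m F = ∑ (words (letters n) m) (λ w → 𝟙ℤ (arranges n c w ∧ derangedFrom p w) * F w)

derangedSum-cong : ∀ n c p m {F G : List ℤ → ℤ} → (∀ w → All (Letter n) w → arranges n c w ≡ true → F w ≡ G w) →
                   derangedSum n c p m F ≡ derangedSum n c p m G
derangedSum-cong n c p m {F} {G} F≗G = ∑-words-cong n m summand
  where
  summand : ∀ w → All (Letter n) w → 𝟙ℤ (arranges n c w ∧ derangedFrom p w) * F w
                                    ≡ 𝟙ℤ (arranges n c w ∧ derangedFrom p w) * G w
  summand w w∈ with arranges n c w in arr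
  ... | true  = cong (𝟙ℤ (derangedFrom p w) *_) (F≗G w w∈ arr)
  ... | false = refl

derangedSum-cong-set : ∀ n {c c′} p m F → (∀ k → k < n → c (suc k) ≡ c′ (suc k)) →
                       derangedSum n c p m F ≡ derangedSum n c′ p m F
derangedSum-cong-set n p m F c≗c′ =
  ∑-cong (words (letters n) m) (λ w → cong (λ b → 𝟙ℤ (b ∧ derangedFrom p w) * F w) (arranges-cong n w c≗c′))

derangedSum-*ˡ : ∀ n c p m k F → derangedSum n c p m (λ w → k * F w) ≡ k * derangedSum n c p m F
derangedSum-*ˡ n c p m k F =
  trans (∑-cong (words (letters n) m) (λ w → reassoc (𝟙ℤ (arranges n c w ∧ derangedFrom p w)) k (F w)))
        (∑-*ˡ (words (letters n) m) k _)
  where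
  reassoc : ∀ a k f → a * (k * f) ≡ k * (a * f)
  reassoc = solve-∀

derangedSum-+ : ∀ n c p m F G → derangedSum n c p m (λ w → F w + G w) ≡ derangedSum n c p m F + derangedSum n c p m G
derangedSum-+ n c p m F G =
  trans (∑-cong (words (letters n) m) (λ w → ℤP.*-distribˡ-+ (𝟙ℤ (arranges n c w ∧ derangedFrom p w)) (F w) (G w)))
        (∑-+ (words (letters n) m) _ _)

derangedSum-step : ∀ n c p m F → derangedSum n c p (suc m) F ≡
  ∑₁ n (λ v → 𝟙ℤ (c v) * (𝟙ℤ (not (v ≡ᵇ suc p)) * derangedSum n (remove c v) (suc p) m (λ w → F (+ v ∷ w))
                          + derangedSum n (remove c v) (suc p) m (λ w → F (- + v ∷ w))))
derangedSum-step n c p m F = begin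
  derangedSum n c p (suc m) F                               ≡⟨ ∑-words (letters n) m _ ⟩
  ∑ (letters n) (λ a → ∑ (words (letters n) m) (λ w → G (a ∷ w))) ≡⟨ ∑-letters n _ ⟩
  ∑₁ n (λ v → head (+ v) + head (- + v))                    ≡⟨ ∑₁-cong n by-sign ⟩
  ∑₁ n (λ v → 𝟙ℤ (c v) * (𝟙ℤ (not (v ≡ᵇ suc p)) * rest v (+ v) + rest v (- + v))) ∎
  where
  open ≡-Reasoning
  G : List ℤ → ℤ
  G w = 𝟙ℤ (arranges n c w ∧ derangedFrom p w) * F w
  head : ℤ → ℤ
  head a = ∑ (words (letters n) m) (λ w → G (a ∷ w))
  rest : ℕ → ℤ → ℤ
  rest v a = derangedSum n (remove c v) (suc p) m (λ w → F (a ∷ w))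
  first : ∀ a → Letter n a → head a ≡ 𝟙ℤ (c ∣ a ∣) * 𝟙ℤ (not (does (a ℤ.≟ + suc p))) * rest ∣ a ∣ a
  first a a∈ = trans (∑-cong (words (letters n) m) split)
                     (∑-*ˡ (words (letters n) m) (𝟙ℤ (c ∣ a ∣) * 𝟙ℤ nf)
                           (λ w → 𝟙ℤ (arranges n (remove c ∣ a ∣) w ∧ derangedFrom (suc p) w) * F (a ∷ w)))
    where
    nf = not (does (a ℤ.≟ + suc p))
    split : ∀ w → G (a ∷ w) ≡ 𝟙ℤ (c ∣ a ∣) * 𝟙ℤ nf
                              * (𝟙ℤ (arranges n (remove c ∣ a ∣) w ∧ derangedFrom (suc p) w) * F (a ∷ w))
    split w = begin
      𝟙ℤ (arranges n c (a ∷ w) ∧ (nf ∧ derangedFrom (suc p) w)) * F (a ∷ w)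
        ≡⟨ cong (λ b → 𝟙ℤ (b ∧ (nf ∧ derangedFrom (suc p) w)) * F (a ∷ w)) (arranges-∷ n c a w a∈) ⟩
      𝟙ℤ ((c ∣ a ∣ ∧ arranges n (remove c ∣ a ∣) w) ∧ (nf ∧ derangedFrom (suc p) w)) * F (a ∷ w)
        ≡⟨ cong (_* F (a ∷ w))
                (𝟙ℤ-∧-interchange (c ∣ a ∣) (arranges n (remove c ∣ a ∣) w) nf (derangedFrom (suc p) w)) ⟩
      𝟙ℤ (c ∣ a ∣) * 𝟙ℤ nf * 𝟙ℤ (arranges n (remove c ∣ a ∣) w ∧ derangedFrom (suc p) w) * F (a ∷ w)
        ≡⟨ ℤP.*-assoc (𝟙ℤ (c ∣ a ∣) * 𝟙ℤ nf) _ (F (a ∷ w)) ⟩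
      𝟙ℤ (c ∣ a ∣) * 𝟙ℤ nf * (𝟙ℤ (arranges n (remove c ∣ a ∣) w ∧ derangedFrom (suc p) w) * F (a ∷ w)) ∎
  factor : ∀ x y s t → x * y * s + x * 1ℤ * t ≡ x * (y * s + t)
  factor = solve-∀
  by-sign : ∀ k → k < n →
    head (+ suc k) + head (- + suc k)
      ≡ 𝟙ℤ (c (suc k)) * (𝟙ℤ (not (k ≡ᵇ p)) * rest (suc k) (+ suc k) + rest (suc k) (- + suc k))
  by-sign k k<n = trans (cong₂ _+_ (first (+ suc k) (s≤s z≤n , k<n)) (first (- + suc k) (s≤s z≤n , k<n)))
                        (factor (𝟙ℤ (c (suc k))) (𝟙ℤ (not (k ≡ᵇ p))) (rest (suc k) (+ suc k)) (rest (suc k) (- + suc k)))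

derangements : ℕ → (ℕ → Bool) → ℕ → ℕ → ℤ
derangements n c p m = derangedSum n c p m (λ _ → 1ℤ)

signWeight : List ℤ → ℤ
signWeight w = sgn (absInv w ℕ.+ negCount w)

signedDerangements : ℕ → (ℕ → Bool) → ℕ → ℕ → ℤ
signedDerangements n c p m = derangedSum n c p m signWeight

derangements-step : ∀ n c p m → derangements n c p (suc m) ≡
  ∑₁ n (λ v → 𝟙ℤ (c v) * (𝟙ℤ (not (v ≡ᵇ suc p)) + 1ℤ) * derangements n (remove c v) (suc p) m)
derangements-step n c p m = trans (derangedSum-step n c p m (λ _ → 1ℤ))
  (∑₁-cong n (λ k _ → collect (𝟙ℤ (c (suc k))) (𝟙ℤ (not (k ≡ᵇ p))) (derangements n (remove c (suc k)) (suc p) m)))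
  where
  collect : ∀ x y d → x * (y * d + d) ≡ x * (y + 1ℤ) * d
  collect = solve-∀

signWeight-∷⁻ : ∀ v w → signWeight (- + suc v ∷ w) ≡ - 1ℤ * signWeight (+ suc v ∷ w)
signWeight-∷⁻ v w = cong sgn (ℕP.+-suc (countBelow (suc v) w ℕ.+ absInv w) (negCount w))

signedDerangements-step : ∀ n c p m → signedDerangements n c p (suc m) ≡
  ∑₁ n (λ v → 𝟙ℤ (c v) * (𝟙ℤ (not (v ≡ᵇ suc p)) - 1ℤ)
              * derangedSum n (remove c v) (suc p) m (λ w → signWeight (+ v ∷ w)))
signedDerangements-step n c p m = trans (derangedSum-step n c p m signWeight) (∑₁-cong n cancel)
  where
  rest : ℕ → ℤ
  rest v = derangedSum n (remove c v) (suc p) m (λ w → signWeight (+ v ∷ w))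
  collect : ∀ x y s → x * (y * s + - 1ℤ * s) ≡ x * (y - 1ℤ) * s
  collect = solve-∀
  cancel : ∀ k → k < n →
    𝟙ℤ (c (suc k)) * (𝟙ℤ (not (k ≡ᵇ p)) * rest (suc k)
                     + derangedSum n (remove c (suc k)) (suc p) m (λ w → signWeight (- + suc k ∷ w)))
      ≡ 𝟙ℤ (c (suc k)) * (𝟙ℤ (not (k ≡ᵇ p)) - 1ℤ) * rest (suc k)
  cancel k _ = trans (cong (λ t → 𝟙ℤ (c (suc k)) * (𝟙ℤ (not (k ≡ᵇ p)) * rest (suc k) + t)) negated)
                     (collect (𝟙ℤ (c (suc k))) (𝟙ℤ (not (k ≡ᵇ p))) (rest (suc k)))
    where
    negated : derangedSum n (remove c (suc k)) (suc p) m (λ w → signWeight (- + suc k ∷ w)) ≡ - 1ℤ * rest (suc k)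
    negated = trans (derangedSum-cong n _ _ m (λ w _ _ → signWeight-∷⁻ k w))
                    (derangedSum-*ˡ n _ _ m (- 1ℤ) (λ w → signWeight (+ suc k ∷ w)))

signedDerangements≡sgn : ∀ n m p → p ℕ.+ m ≡ n → signedDerangements n (p <ᵇ_) p m ≡ sgn m
signedDerangements≡sgn n zero p p+0≡n = cong (λ b → 𝟙ℤ (b ∧ true) * 1ℤ + 0ℤ) (arranges-∅ n (p <ᵇ_) nothing-above)
  where
  n≤p : n ≤ p
  n≤p = ℕP.≤-reflexive (trans (sym p+0≡n) (ℕP.+-identityʳ p))
  nothing-above : card n (p <ᵇ_) ≡ 0
  nothing-above = trans (card-cong n (λ k k<n → ≥⇒<ᵇ-false (ℕP.≤-trans k<n n≤p))) (card-∅ n)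
signedDerangements≡sgn n (suc m) p p+1+m≡n = begin
  signedDerangements n (p <ᵇ_) p (suc m)              ≡⟨ signedDerangements-step n (p <ᵇ_) p m ⟩
  -- the two signs of a first letter v cancel, unless v = p + 1, which fits only with a minus sign
  ∑₁ n (λ v → Z v)                                    ≡⟨ ∑₁-cong n (λ k _ → only-least (suc k)) ⟩
  ∑₁ n (λ v → if v ≡ᵇ q then Z v else 0ℤ)             ≡⟨ ∑₁-point n q Z (s≤s z≤n) q≤n ⟩
  Z q                                                 ≡⟨ cong₂ (λ b y → 𝟙ℤ (p <ᵇ q) * (𝟙ℤ (not b) - 1ℤ) * y) (≡ᵇ-refl p) Y≡ ⟩
  𝟙ℤ (p <ᵇ q) * (0ℤ - 1ℤ) * signedDerangements n (q <ᵇ_) q m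
    ≡⟨ cong (λ b → 𝟙ℤ b * (0ℤ - 1ℤ) * signedDerangements n (q <ᵇ_) q m) (<⇒<ᵇ-true (ℕP.n<1+n p)) ⟩
  - 1ℤ * signedDerangements n (q <ᵇ_) q m             ≡⟨ cong (- 1ℤ *_) (signedDerangements≡sgn n m q q+m≡n) ⟩
  sgn (suc m)                                         ∎
  where
  open ≡-Reasoning
  q = suc p
  q+m≡n : q ℕ.+ m ≡ n
  q+m≡n = trans (sym (ℕP.+-suc p m)) p+1+m≡n
  q≤n : q ≤ n
  q≤n = ℕP.≤-trans (ℕP.m≤m+n q m) (ℕP.≤-reflexive q+m≡n)
  Y : ℕ → ℤ
  Y v = derangedSum n (remove (p <ᵇ_) v) q m (λ w → signWeight (+ v ∷ w))
  Z : ℕ → ℤ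
  Z v = 𝟙ℤ (p <ᵇ v) * (𝟙ℤ (not (v ≡ᵇ q)) - 1ℤ) * Y v
  only-least : ∀ v → Z v ≡ (if v ≡ᵇ q then Z v else 0ℤ)
  only-least v with v ≡ᵇ q
  ... | true  = refl
  ... | false = cancels (𝟙ℤ (p <ᵇ v)) (Y v)
    where
    cancels : ∀ a y → a * (1ℤ - 1ℤ) * y ≡ 0ℤ
    cancels = solve-∀
  Y≡ : Y q ≡ signedDerangements n (q <ᵇ_) q m
  Y≡ = trans (derangedSum-cong-set n q m _ (λ k _ → remove-least p (suc k))) (derangedSum-cong n (q <ᵇ_) q m drop-head)
    where
    drop-head : ∀ w → All (Letter n) w → arranges n (q <ᵇ_) w ≡ true → signWeight (+ q ∷ w) ≡ signWeight w
    drop-head w w∈ arr = cong (λ z → sgn (z ℕ.+ absInv w ℕ.+ negCount w))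
      (trans (countBelow-arranges n (q <ᵇ_) q w w∈ arr) (trans (card-cong n (λ k _ → <ᵇ-asym (suc k) q)) (card-∅ n)))

-- Counting partial derangements

-- avoid m k counts the partial derangements of size m in which k of the values could be fixed points; the
-- recurrence is inclusion–exclusion on one of these k values.
avoid : ℕ → ℕ → ℤ
avoid m       zero    = + (2 ^ m ℕ.* m !)
avoid zero    (suc k) = 0ℤ
avoid (suc m) (suc k) = avoid (suc m) k - avoid m k

avoid-∸1 : ∀ m j → + j * avoid (suc m) (j ∸ 1) ≡ + j * (avoid (suc m) j + avoid m (j ∸ 1))
avoid-∸1 m zero    = refl
avoid-∸1 m (suc j) = cong (+ suc j *_) (sub-add (avoid (suc m) j) (avoid m j))
  where
  sub-add : ∀ a b → a ≡ a - b + b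
  sub-add = solve-∀

avoid-suc : ∀ m j → j ≤ m → avoid (suc m) j ≡ + 2 * + j * avoid m (j ∸ 1) + + 2 * (+ suc m - + j) * avoid m j
avoid-suc m zero _ = begin
  + (2 ℕ.* 2 ^ m ℕ.* (suc m ℕ.* m !))            ≡⟨ ℤP.pos-* (2 ℕ.* 2 ^ m) (suc m ℕ.* m !) ⟩
  + (2 ℕ.* 2 ^ m) * + (suc m ℕ.* m !)            ≡⟨ cong₂ _*_ (ℤP.pos-* 2 (2 ^ m)) (ℤP.pos-* (suc m) (m !)) ⟩
  + 2 * + (2 ^ m) * ((1ℤ + + m) * + (m !))       ≡⟨ regroup (+ (2 ^ m)) (+ (m !)) (+ m) ⟩
  + 2 * + 0 * (+ (2 ^ m) * + (m !)) + + 2 * ((1ℤ + + m) - + 0) * (+ (2 ^ m) * + (m !))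
    ≡⟨ cong (λ a → + 2 * + 0 * a + + 2 * ((1ℤ + + m) - + 0) * a) (sym (ℤP.pos-* (2 ^ m) (m !))) ⟩
  + 2 * + 0 * avoid m 0 + + 2 * (+ suc m - + 0) * avoid m 0 ∎
  where
  open ≡-Reasoning
  regroup : ∀ P F M → + 2 * P * ((1ℤ + M) * F) ≡ + 2 * + 0 * (P * F) + + 2 * ((1ℤ + M) - + 0) * (P * F)
  regroup = solve-∀
avoid-suc zero    (suc j) ()
avoid-suc (suc m) (suc j) (s≤s j≤m) = begin
  T₂ - A                                                      ≡⟨ combination (+ j) (+ m) T₂ A P B C ⟩
  -- each bracketed difference vanishes, by an induction hypothesis or by avoid-∸1
  R + (T₂ - (+ 2 * + j * P + + 2 * (+ suc (suc m) - + j) * A))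
    + + 2 * (+ j * P - + j * (A + B))
    - (A - (+ 2 * + j * B + + 2 * (+ suc m - + j) * C))
    ≡⟨ cong₂ (λ d₁ d₂ → R + d₁ + + 2 * d₂ - (A - (+ 2 * + j * B + + 2 * (+ suc m - + j) * C)))
             (ℤP.i≡j⇒i-j≡0 (avoid-suc (suc m) j (ℕP.m≤n⇒m≤1+n j≤m))) (ℤP.i≡j⇒i-j≡0 (avoid-∸1 m j)) ⟩
  R + 0ℤ + + 2 * 0ℤ - (A - (+ 2 * + j * B + + 2 * (+ suc m - + j) * C))
    ≡⟨ cong (λ d → R + 0ℤ + + 2 * 0ℤ - d) (ℤP.i≡j⇒i-j≡0 (avoid-suc m j j≤m)) ⟩
  R + 0ℤ + + 2 * 0ℤ - 0ℤ                                      ≡⟨ vanish R ⟩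
  R                                                           ∎
  where
  open ≡-Reasoning
  T₂ = avoid (suc (suc m)) j
  A = avoid (suc m) j
  P = avoid (suc m) (j ∸ 1)
  B = avoid m (j ∸ 1)
  C = avoid m j
  R = + 2 * + suc j * A + + 2 * (+ suc (suc m) - + suc j) * (A - C)
  combination : ∀ J M T A P B C →
    T - A ≡ + 2 * (1ℤ + J) * A + + 2 * ((1ℤ + (1ℤ + M)) - (1ℤ + J)) * (A - C)
            + (T - (+ 2 * J * P + + 2 * ((1ℤ + (1ℤ + M)) - J) * A))
            + + 2 * (J * P - J * (A + B))
            - (A - (+ 2 * J * B + + 2 * ((1ℤ + M) - J) * C))
  combination = solve-∀
  vanish : ∀ R → R + 0ℤ + + 2 * 0ℤ - 0ℤ ≡ R
  vanish = solve-∀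

avoid-suc-suc : ∀ m j → j ≤ m → avoid (suc m) (suc j) ≡ (+ 2 * (+ m - + j) + 1ℤ) * avoid m j + + 2 * + j * avoid m (j ∸ 1)
avoid-suc-suc m j j≤m = trans (cong (_- avoid m j) (avoid-suc m j j≤m))
                              (regroup (+ j) (+ m) (avoid m (j ∸ 1)) (avoid m j))
  where
  regroup : ∀ J M P C → + 2 * J * P + + 2 * ((1ℤ + M) - J) * C - C ≡ (+ 2 * (M - J) + 1ℤ) * C + + 2 * J * P
  regroup = solve-∀

avoid-diagonal : ∀ n → avoid (suc n) (suc n) ≡ + 2 * + suc n * avoid n n + sgn (suc n)
avoid-diagonal zero    = refl
avoid-diagonal (suc n) = begin
  avoid (2 ℕ.+ n) (2 ℕ.+ n)                                     ≡⟨ avoid-suc-suc (suc n) (suc n) ℕP.≤-refl ⟩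
  (+ 2 * (+ suc n - + suc n) + 1ℤ) * (A - B) + + 2 * + suc n * A  ≡⟨ combination (+ suc n) A B (sgn (suc n)) ⟩
  + 2 * (1ℤ + + suc n) * (A - B) + - 1ℤ * sgn (suc n) - (A - B - (+ 2 * + suc n * B + sgn (suc n)))
    ≡⟨ cong (λ d → + 2 * (1ℤ + + suc n) * (A - B) + - 1ℤ * sgn (suc n) - d) (ℤP.i≡j⇒i-j≡0 (avoid-diagonal n)) ⟩
  + 2 * (1ℤ + + suc n) * (A - B) + - 1ℤ * sgn (suc n) - 0ℤ      ≡⟨ ℤP.+-identityʳ _ ⟩
  + 2 * + suc (suc n) * avoid (suc n) (suc n) + sgn (suc (suc n)) ∎
  where
  open ≡-Reasoning
  A = avoid (suc n) n
  B = avoid n n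
  combination : ∀ S A B s → (+ 2 * (S - S) + 1ℤ) * (A - B) + + 2 * S * A
                            ≡ + 2 * (1ℤ + S) * (A - B) + - 1ℤ * s - (A - B - (+ 2 * S * B + s))
  combination = solve-∀

avoid-suc-by-cases : ∀ m N K (b : Bool) → suc m ≡ N ℕ.+ 𝟙 b ℕ.+ K → (b ≡ false → K ≤ m) →
  + N * (+ 2 * avoid m K) + 𝟙ℤ b * avoid m K + + K * (+ 2 * avoid m (K ∸ 1)) ≡ avoid (suc m) (𝟙 b ℕ.+ K)
avoid-suc-by-cases m N K true  m≡ _ = begin
  + N * (+ 2 * avoid m K) + 1ℤ * avoid m K + + K * (+ 2 * avoid m (K ∸ 1))
    ≡⟨ regroup (+ N) (+ K) (avoid m K) (avoid m (K ∸ 1)) ⟩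
  (+ 2 * ((+ N + + K) - + K) + 1ℤ) * avoid m K + + 2 * + K * avoid m (K ∸ 1)
    ≡⟨ cong (λ a → (+ 2 * (+ a - + K) + 1ℤ) * avoid m K + + 2 * + K * avoid m (K ∸ 1)) (sym m≡N+K) ⟩
  (+ 2 * (+ m - + K) + 1ℤ) * avoid m K + + 2 * + K * avoid m (K ∸ 1)
    ≡⟨ sym (avoid-suc-suc m K (ℕP.≤-trans (ℕP.m≤n+m K N) (ℕP.≤-reflexive (sym m≡N+K)))) ⟩
  avoid (suc m) (suc K) ∎
  where
  open ≡-Reasoning
  m≡N+K : m ≡ N ℕ.+ K
  m≡N+K = ℕP.suc-injective (trans m≡ (cong (ℕ._+ K) (ℕP.+-comm N 1)))
  regroup : ∀ N K A B → N * (+ 2 * A) + 1ℤ * A + K * (+ 2 * B) ≡ (+ 2 * ((N + K) - K) + 1ℤ) * A + + 2 * K * B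
  regroup = solve-∀
avoid-suc-by-cases m N K false m≡ K≤m = begin
  + N * (+ 2 * avoid m K) + 0ℤ * avoid m K + + K * (+ 2 * avoid m (K ∸ 1))
    ≡⟨ regroup (+ N) (+ K) (avoid m K) (avoid m (K ∸ 1)) ⟩
  + 2 * + K * avoid m (K ∸ 1) + + 2 * ((+ N + + K) - + K) * avoid m K
    ≡⟨ cong (λ a → + 2 * + K * avoid m (K ∸ 1) + + 2 * (+ a - + K) * avoid m K)
            (sym (trans m≡ (cong (ℕ._+ K) (ℕP.+-identityʳ N)))) ⟩
  + 2 * + K * avoid m (K ∸ 1) + + 2 * (+ suc m - + K) * avoid m K
    ≡⟨ sym (avoid-suc m K (K≤m refl)) ⟩
  avoid (suc m) K ∎
  where
  open ≡-Reasoning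
  regroup : ∀ N K A B → N * (+ 2 * A) + 0ℤ * A + K * (+ 2 * B) ≡ + 2 * K * B + + 2 * ((N + K) - K) * A
  regroup = solve-∀

above : ℕ → (ℕ → Bool) → ℕ → ℕ
above n c p = card n (λ k → (p <ᵇ k) ∧ c k)

above-∅ : ∀ n c p → card n c ≡ 0 → above n c p ≡ 0
above-∅ n c p empty =
  trans (card-cong n (λ k k<n → trans (cong ((p <ᵇ suc k) ∧_) (card≡0⇒∅ n c empty k k<n)) (𝔹P.∧-zeroʳ _)))
        (card-∅ n)

above-suc : ∀ n c p → suc p ≤ n → above n c p ≡ 𝟙 (c (suc p)) ℕ.+ above n c (suc p)
above-suc n c p q≤n = ℤP.+-injective (begin
  + above n c p                                                            ≡⟨ sym (∑₁-𝟙 n _) ⟩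
  ∑₁ n (λ k → 𝟙ℤ ((p <ᵇ k) ∧ c k))                                         ≡⟨ ∑₁-cong n (λ k _ → split (c (suc k)) (suc k)) ⟩
  ∑₁ n (λ k → (if k ≡ᵇ suc p then 𝟙ℤ (c k) else 0ℤ) + 𝟙ℤ ((suc p <ᵇ k) ∧ c k)) ≡⟨ ∑₁-+ n _ _ ⟩
  ∑₁ n (λ k → if k ≡ᵇ suc p then 𝟙ℤ (c k) else 0ℤ) + ∑₁ n (λ k → 𝟙ℤ ((suc p <ᵇ k) ∧ c k))
    ≡⟨ cong₂ _+_ (∑₁-point n (suc p) (λ k → 𝟙ℤ (c k)) (s≤s z≤n) q≤n) (∑₁-𝟙 n _) ⟩
  𝟙ℤ (c (suc p)) + + above n c (suc p)                                     ∎)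
  where
  open ≡-Reasoning
  split : ∀ ck k → 𝟙ℤ ((p <ᵇ k) ∧ ck) ≡ (if k ≡ᵇ suc p then 𝟙ℤ ck else 0ℤ) + 𝟙ℤ ((suc p <ᵇ k) ∧ ck)
  split ck k with compareᵇ k (suc p)
  ... | less k<q k≢q q≮k rewrite k≢q | q≮k | ≥⇒<ᵇ-false (ℕP.≤-pred (<ᵇ-true⇒< k (suc p) k<q)) = refl
  ... | equal _ k≡q _ rewrite ≡ᵇ⇒≡ k (suc p) k≡q | ≡ᵇ-refl p | ≥⇒<ᵇ-false (ℕP.≤-refl {p})
                            | <⇒<ᵇ-true (ℕP.n<1+n p) = sym (ℤP.+-identityʳ (𝟙ℤ ck))
  ... | greater _ k≢q q<k rewrite k≢q | q<k
                                | <⇒<ᵇ-true (ℕP.<-trans (ℕP.n<1+n p) (<ᵇ-true⇒< (suc p) k q<k)) = refl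

above-remove : ∀ n c q v → 1 ≤ v → v ≤ n → c v ≡ true → above n (remove c v) q ℕ.+ 𝟙 (q <ᵇ v) ≡ above n c q
above-remove n c q v 1≤v v≤n cv with q <ᵇ v in q<v
... | true  = trans (cong (ℕ._+ 1) (card-cong n (λ k _ → sym (𝔹P.∧-assoc (q <ᵇ suc k) (c (suc k)) _))))
                    (card-remove n (λ k → (q <ᵇ k) ∧ c k) v 1≤v v≤n (trans (cong (_∧ c v) q<v) cv))
... | false = trans (ℕP.+-identityʳ _) (card-cong n unchanged)
  where
  unchanged : ∀ k → k < n → (q <ᵇ suc k) ∧ remove c v (suc k) ≡ (q <ᵇ suc k) ∧ c (suc k)
  unchanged k _ with suc k ≡ᵇ v in k≡v
  ... | true  rewrite ≡ᵇ⇒≡ (suc k) v k≡v | q<v = refl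
  ... | false = cong ((q <ᵇ suc k) ∧_) (𝔹P.∧-identityʳ (c (suc k)))

first-letter-contribution : ∀ cv v q K′ K (t : ℕ → ℤ) → (cv ≡ true → K′ ℕ.+ 𝟙 (q <ᵇ v) ≡ K) →
  𝟙ℤ cv * (𝟙ℤ (not (v ≡ᵇ q)) + 1ℤ) * t K′
    ≡ 𝟙ℤ (cv ∧ (v <ᵇ q)) * (+ 2 * t K) + (if v ≡ᵇ q then 𝟙ℤ cv * t K else 0ℤ) + 𝟙ℤ ((q <ᵇ v) ∧ cv) * (+ 2 * t (K ∸ 1))
first-letter-contribution false v q K′ K t _ rewrite 𝔹P.∧-zeroʳ (q <ᵇ v) with v ≡ᵇ q
... | true  = refl
... | false = refl
first-letter-contribution true v q K′ K t K′≡ with compareᵇ v q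
... | less v<q v≢q q≮v rewrite v<q | v≢q | q≮v | sym (trans (sym (ℕP.+-identityʳ K′)) (K′≡ refl)) =
  twice (t K′) (t (K′ ∸ 1))
  where
  twice : ∀ a c → 1ℤ * (1ℤ + 1ℤ) * a ≡ 1ℤ * (+ 2 * a) + 0ℤ + 0ℤ * (+ 2 * c)
  twice = solve-∀
... | equal v≮q v≡q q≮v rewrite v≮q | v≡q | q≮v | sym (trans (sym (ℕP.+-identityʳ K′)) (K′≡ refl)) =
  once (t K′) (t (K′ ∸ 1))
  where
  once : ∀ a c → 1ℤ * (0ℤ + 1ℤ) * a ≡ 0ℤ * (+ 2 * a) + 1ℤ * a + 0ℤ * (+ 2 * c)
  once = solve-∀
... | greater v≮q v≢q q<v rewrite v≮q | v≢q | q<v | sym (trans (ℕP.+-comm 1 K′) (K′≡ refl)) =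
  twice (t K′) (t (suc K′))
  where
  twice : ∀ a c → 1ℤ * (1ℤ + 1ℤ) * a ≡ 0ℤ * (+ 2 * c) + 0ℤ + 1ℤ * (+ 2 * a)
  twice = solve-∀

avoid-by-first-letter : ∀ n m p c → suc p ℕ.+ m ≡ n → card n c ≡ suc m →
  ∑₁ n (λ v → 𝟙ℤ (c v) * (𝟙ℤ (not (v ≡ᵇ suc p)) + 1ℤ) * avoid m (above n (remove c v) (suc p)))
    ≡ avoid (suc m) (above n c p)
avoid-by-first-letter n m p c q+m≡n card≡ = begin
  ∑₁ n (λ v → 𝟙ℤ (c v) * (𝟙ℤ (not (v ≡ᵇ q)) + 1ℤ) * avoid m (above n (remove c v) q))
    ≡⟨ ∑₁-cong n (λ k k<n → first-letter-contribution (c (suc k)) (suc k) q _ K (avoid m)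
                              (above-remove n c q (suc k) (s≤s z≤n) k<n)) ⟩
  ∑₁ n (λ v → 𝟙ℤ (c v ∧ (v <ᵇ q)) * (+ 2 * avoid m K) + (if v ≡ᵇ q then 𝟙ℤ (c v) * avoid m K else 0ℤ)
              + 𝟙ℤ ((q <ᵇ v) ∧ c v) * (+ 2 * avoid m (K ∸ 1)))
    ≡⟨ ∑₁-trichotomy n q c (+ 2 * avoid m K) (avoid m K) (+ 2 * avoid m (K ∸ 1)) (s≤s z≤n) q≤n ⟩
  + N * (+ 2 * avoid m K) + 𝟙ℤ (c q) * avoid m K + + K * (+ 2 * avoid m (K ∸ 1))
    ≡⟨ avoid-suc-by-cases m N K (c q) (trans (sym card≡) (card-trichotomy n q c (s≤s z≤n) q≤n)) K≤m ⟩
  avoid (suc m) (𝟙 (c q) ℕ.+ K)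
    ≡⟨ cong (avoid (suc m)) (sym (above-suc n c p q≤n)) ⟩
  avoid (suc m) (above n c p) ∎
  where
  open ≡-Reasoning
  q = suc p
  N = card n (λ v → c v ∧ (v <ᵇ q))
  K = above n c q
  q≤n : q ≤ n
  q≤n = ℕP.≤-trans (ℕP.m≤m+n q m) (ℕP.≤-reflexive q+m≡n)
  K≤m : c q ≡ false → K ≤ m
  K≤m _ = ℕP.≤-trans (card-above n q c) (ℕP.≤-reflexive (trans (cong (ℕ._∸ q) (sym q+m≡n)) (ℕP.m+n∸m≡n q m)))

derangements≡avoid : ∀ n m p c → p ℕ.+ m ≡ n → card n c ≡ m → derangements n c p m ≡ avoid m (above n c p)
derangements≡avoid n zero    p c _        empty rewrite arranges-∅ n c empty | above-∅ n c p empty = refl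
derangements≡avoid n (suc m) p c p+1+m≡n card≡ = begin
  derangements n c p (suc m)
    ≡⟨ derangements-step n c p m ⟩
  ∑₁ n (λ v → 𝟙ℤ (c v) * (𝟙ℤ (not (v ≡ᵇ q)) + 1ℤ) * derangements n (remove c v) q m)
    ≡⟨ ∑₁-cong n by-induction ⟩
  ∑₁ n (λ v → 𝟙ℤ (c v) * (𝟙ℤ (not (v ≡ᵇ q)) + 1ℤ) * avoid m (above n (remove c v) q))
    ≡⟨ avoid-by-first-letter n m p c q+m≡n card≡ ⟩
  avoid (suc m) (above n c p) ∎
  where
  open ≡-Reasoning
  q = suc p
  q+m≡n : q ℕ.+ m ≡ n
  q+m≡n = trans (sym (ℕP.+-suc p m)) p+1+m≡n
  by-induction : ∀ k → k < n →
      𝟙ℤ (c (suc k)) * (𝟙ℤ (not (suc k ≡ᵇ q)) + 1ℤ) * derangements n (remove c (suc k)) q m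
    ≡ 𝟙ℤ (c (suc k)) * (𝟙ℤ (not (suc k ≡ᵇ q)) + 1ℤ) * avoid m (above n (remove c (suc k)) q)
  by-induction k k<n with c (suc k) in ck
  ... | false = refl
  ... | true  = cong (1ℤ * (𝟙ℤ (not (k ≡ᵇ p)) + 1ℤ) *_)
                     (derangements≡avoid n m q (remove c (suc k)) q+m≡n
                       (ℕP.suc-injective (trans (ℕP.+-comm 1 _) (trans (card-remove n c (suc k) (s≤s z≤n) k<n ck) card≡))))

twice-𝟙-isEven : ∀ ℓ → + 2 * 𝟙ℤ (isEven ℓ) ≡ 1ℤ + sgn ℓ
twice-𝟙-isEven zero          = refl
twice-𝟙-isEven (suc zero)    = refl
twice-𝟙-isEven (suc (suc ℓ)) = trans (twice-𝟙-isEven ℓ) (cong (_+_ 1ℤ) (double-negation (sgn ℓ)))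
  where
  double-negation : ∀ s → s ≡ - 1ℤ * (- 1ℤ * s)
  double-negation = solve-∀

dAB-summand : ∀ n σ → All (Letter n) σ →
  + 2 * (𝟙ℤ (does (isSignedPerm n σ 𝔹P.≟ true)) * (𝟙ℤ (does ((isDerangement σ ∧ isEven (ℓB σ)) 𝔹P.≟ true)) * 1ℤ))
    ≡ 𝟙ℤ (arranges n (0 <ᵇ_) σ ∧ derangedFrom 0 σ) * (1ℤ + signWeight σ)
dAB-summand n σ σ∈ = begin
  + 2 * (𝟙ℤ (does (isSignedPerm n σ 𝔹P.≟ true)) * (𝟙ℤ (does ((isDerangement σ ∧ isEven (ℓB σ)) 𝔹P.≟ true)) * 1ℤ))
    ≡⟨ cong₂ (λ a b → + 2 * (𝟙ℤ a * (𝟙ℤ b * 1ℤ)))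
             (trans (does-≟true _) (trans (isSignedPerm≡arranges n σ) all≡))
             (trans (does-≟true _) (cong (_∧ isEven (ℓB σ)) (isDerangement≡derangedFrom σ))) ⟩
  + 2 * (𝟙ℤ (arranges n (0 <ᵇ_) σ) * (𝟙ℤ (derangedFrom 0 σ ∧ isEven (ℓB σ)) * 1ℤ))
    ≡⟨ cases (arranges n (0 <ᵇ_) σ) (derangedFrom 0 σ) (λ arr → sgn-ℓB n σ σ∈ (trans all≡ arr)) ⟩
  𝟙ℤ (arranges n (0 <ᵇ_) σ ∧ derangedFrom 0 σ) * (1ℤ + signWeight σ) ∎
  where
  open ≡-Reasoning
  all≡ : arranges n (λ _ → true) σ ≡ arranges n (0 <ᵇ_) σ
  all≡ = arranges-cong n σ (λ _ _ → refl)
  cases : ∀ a d → (a ≡ true → sgn (ℓB σ) ≡ signWeight σ) →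
          + 2 * (𝟙ℤ a * (𝟙ℤ (d ∧ isEven (ℓB σ)) * 1ℤ)) ≡ 𝟙ℤ (a ∧ d) * (1ℤ + signWeight σ)
  cases false d     _      = refl
  cases true  false _      = refl
  cases true  true  parity = begin
    + 2 * (1ℤ * (𝟙ℤ (isEven (ℓB σ)) * 1ℤ)) ≡⟨ cong (+ 2 *_) (trans (ℤP.*-identityˡ (𝟙ℤ (isEven (ℓB σ)) * 1ℤ))
                                                                   (ℤP.*-identityʳ (𝟙ℤ (isEven (ℓB σ))))) ⟩
    + 2 * 𝟙ℤ (isEven (ℓB σ))               ≡⟨ twice-𝟙-isEven (ℓB σ) ⟩
    1ℤ + sgn (ℓB σ)                         ≡⟨ cong (_+_ 1ℤ) (parity refl) ⟩
    1ℤ + signWeight σ                       ≡⟨ sym (ℤP.*-identityˡ _) ⟩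
    1ℤ * (1ℤ + signWeight σ)                ∎

twice-dAB : ∀ n → + 2 * + dAB n ≡ avoid n n + sgn n
twice-dAB n = begin
  + 2 * + dAB n
    ≡⟨ cong (+ 2 *_) (trans (length≡∑1 (filter isEvenDerangement? (Bn n))) (∑-filter isEvenDerangement? (Bn n) _)) ⟩
  + 2 * ∑ (Bn n) (λ σ → 𝟙ℤ (does (isEvenDerangement? σ)) * 1ℤ)
    ≡⟨ cong (+ 2 *_) (∑-filter isSignedPerm? (words (letters n) n) _) ⟩
  + 2 * ∑ (words (letters n) n) (λ σ → 𝟙ℤ (does (isSignedPerm? σ)) * (𝟙ℤ (does (isEvenDerangement? σ)) * 1ℤ))
    ≡⟨ sym (∑-*ˡ (words (letters n) n) (+ 2) _) ⟩
  ∑ (words (letters n) n) (λ σ → + 2 * (𝟙ℤ (does (isSignedPerm? σ)) * (𝟙ℤ (does (isEvenDerangement? σ)) * 1ℤ)))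
    ≡⟨ ∑-words-cong n n (dAB-summand n) ⟩
  derangedSum n (0 <ᵇ_) 0 n (λ σ → 1ℤ + signWeight σ)
    ≡⟨ derangedSum-+ n (0 <ᵇ_) 0 n (λ _ → 1ℤ) signWeight ⟩
  derangements n (0 <ᵇ_) 0 n + signedDerangements n (0 <ᵇ_) 0 n
    ≡⟨ cong₂ _+_ (derangements≡avoid n n 0 (0 <ᵇ_) refl (card-full n _ (λ _ _ → refl))) (signedDerangements≡sgn n n 0 refl) ⟩
  avoid n (above n (0 <ᵇ_) 0) + sgn n
    ≡⟨ cong (λ k → avoid n k + sgn n) (card-full n _ (λ _ _ → refl)) ⟩
  avoid n n + sgn n ∎
  where
  open ≡-Reasoning
  isEvenDerangement? : (σ : List ℤ) → Dec ((isDerangement σ ∧ isEven (ℓB σ)) ≡ true)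
  isEvenDerangement? σ = (isDerangement σ ∧ isEven (ℓB σ)) 𝔹P.≟ true
  isSignedPerm? : (σ : List ℤ) → Dec (isSignedPerm n σ ≡ true)
  isSignedPerm? σ = isSignedPerm n σ 𝔹P.≟ true

dAB-suc : ∀ m → + dAB (suc m) ≡ + (2 ℕ.* suc m) * + dAB m + sgn (suc m) * + (suc m ℕ.+ 1)
dAB-suc m = ℤP.*-cancelˡ-≡ (+ 2) _ _ (begin
  + 2 * + dAB (suc m)                                                  ≡⟨ twice-dAB (suc m) ⟩
  avoid (suc m) (suc m) + sgn (suc m)                                  ≡⟨ cong (_+ sgn (suc m)) (avoid-diagonal m) ⟩
  + 2 * + suc m * avoid m m + sgn (suc m) + sgn (suc m)                ≡⟨ cong (λ a → + 2 * + suc m * a + sgn (suc m) + sgn (suc m)) avoid≡ ⟩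
  + 2 * + suc m * (+ 2 * + dAB m - sgn m) + - 1ℤ * sgn m + - 1ℤ * sgn m ≡⟨ regroup (+ suc m) (+ dAB m) (sgn m) ⟩
  + 2 * (+ 2 * + suc m * + dAB m + - 1ℤ * sgn m * (+ suc m + 1ℤ))
    ≡⟨ cong (λ a → + 2 * (a * + dAB m + - 1ℤ * sgn m * (+ suc m + 1ℤ))) (sym (ℤP.pos-* 2 (suc m))) ⟩
  + 2 * (+ (2 ℕ.* suc m) * + dAB m + sgn (suc m) * + (suc m ℕ.+ 1))    ∎)
  where
  open ≡-Reasoning
  avoid≡ : avoid m m ≡ + 2 * + dAB m - sgn m
  avoid≡ = trans (add-sub (avoid m m) (sgn m)) (cong (_- sgn m) (sym (twice-dAB m)))
    where
    add-sub : ∀ a s → a ≡ a + s - s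
    add-sub = solve-∀
  regroup : ∀ M d s → + 2 * M * (+ 2 * d - s) + - 1ℤ * s + - 1ℤ * s ≡ + 2 * (+ 2 * M * d + - 1ℤ * s * (M + 1ℤ))
  regroup = solve-∀

dAB-1 : dAB 1 ≡ 0
dAB-1 = refl

dAB-2 : dAB 2 ≡ 3
dAB-2 = refl

-- scaledSum n = n! Σ_{k<n} 2^{n−k−1} (−1)^k / k!
scaledSum : ℕ → ℤ
scaledSum zero    = 0ℤ
scaledSum (suc m) = + 2 * + suc m * scaledSum m + + suc m * sgn m

module Recurrence (d : ℕ → ℤ) (d-suc : ∀ m → d (suc m) ≡ + (2 ℕ.* suc m) * d m + sgn (suc m) * + (suc m ℕ.+ 1)) where

  three-term : ∀ m → d (suc (suc m)) ≡ + suc m * (+ 2 * d (suc m) + + 4 * d m + sgn (suc m))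
  three-term m rewrite d-suc (suc m) | d-suc m | ℤP.pos-* 2 (suc (suc m)) | ℤP.pos-* 2 (suc m) =
    regroup (+ suc m) (d m) (sgn m)
    where
    regroup : ∀ M d s →
      + 2 * (1ℤ + M) * (+ 2 * M * d + - 1ℤ * s * (M + 1ℤ)) + - 1ℤ * (- 1ℤ * s) * ((1ℤ + M) + 1ℤ)
        ≡ M * (+ 2 * (+ 2 * M * d + - 1ℤ * s * (M + 1ℤ)) + + 4 * d + - 1ℤ * s)
    regroup = solve-∀

  ≡scaledSum+sgn : d 1 ≡ 0ℤ → ∀ m → d (suc m) ≡ scaledSum (suc m) + sgn (suc m)
  ≡scaledSum+sgn d₁ zero    = d₁
  ≡scaledSum+sgn d₁ (suc m) rewrite d-suc (suc m) | ≡scaledSum+sgn d₁ m | ℤP.pos-* 2 (suc (suc m)) =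
    regroup (+ suc m) (scaledSum m) (sgn m)
    where
    regroup : ∀ M g s →
      + 2 * (1ℤ + M) * (+ 2 * M * g + M * s + - 1ℤ * s) + - 1ℤ * (- 1ℤ * s) * ((1ℤ + M) + 1ℤ)
        ≡ + 2 * (1ℤ + M) * (+ 2 * M * g + M * s) + (1ℤ + M) * (- 1ℤ * s) + - 1ℤ * (- 1ℤ * s)
    regroup = solve-∀

-- The explicit formula

toℚᵘ-/suc : ∀ i k → ℚ.toℚᵘ (i ℚ./ suc k) ≃ᵘ mkℚᵘ i k
toℚᵘ-/suc i k = ℚP.toℚᵘ-fromℚᵘ (mkℚᵘ i k)

/1-+ : ∀ a b → (a ℚ./ 1) ℚ.+ (b ℚ./ 1) ≡ (a + b) ℚ./ 1
/1-+ a b = ℚP.toℚᵘ-injective (begin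
  ℚ.toℚᵘ ((a ℚ./ 1) ℚ.+ (b ℚ./ 1))            ≈⟨ ℚP.toℚᵘ-homo-+ (a ℚ./ 1) (b ℚ./ 1) ⟩
  ℚ.toℚᵘ (a ℚ./ 1) ℚᵘ.+ ℚ.toℚᵘ (b ℚ./ 1)      ≈⟨ ℚᵘP.+-cong (toℚᵘ-/suc a 0) (toℚᵘ-/suc b 0) ⟩
  mkℚᵘ a 0 ℚᵘ.+ mkℚᵘ b 0                      ≈⟨ *≡* (regroup a b) ⟩
  mkℚᵘ (a + b) 0                              ≈⟨ ℚᵘP.≃-sym (toℚᵘ-/suc (a + b) 0) ⟩
  ℚ.toℚᵘ ((a + b) ℚ./ 1)                      ∎)
  where
  open ℚᵘP.≃-Reasoning
  regroup : ∀ a b → (a * 1ℤ + b * 1ℤ) * 1ℤ ≡ (a + b) * 1ℤ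
  regroup = solve-∀

/1-*-/ : ∀ a i d {{_ : ℕ.NonZero d}} → (a ℚ./ 1) ℚ.* (i ℚ./ d) ≡ (a * i) ℚ./ d
/1-*-/ a i zero    {{()}}
/1-*-/ a i (suc k) = ℚP.toℚᵘ-injective (begin
  ℚ.toℚᵘ ((a ℚ./ 1) ℚ.* (i ℚ./ suc k))        ≈⟨ ℚP.toℚᵘ-homo-* (a ℚ./ 1) (i ℚ./ suc k) ⟩
  ℚ.toℚᵘ (a ℚ./ 1) ℚᵘ.* ℚ.toℚᵘ (i ℚ./ suc k)  ≈⟨ ℚᵘP.*-cong (toℚᵘ-/suc a 0) (toℚᵘ-/suc i k) ⟩
  mkℚᵘ a 0 ℚᵘ.* mkℚᵘ i k                      ≈⟨ *≡* (cong (λ d → a * i * + suc d) (sym (ℕP.+-identityʳ k))) ⟩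
  mkℚᵘ (a * i) k                              ≈⟨ ℚᵘP.≃-sym (toℚᵘ-/suc (a * i) k) ⟩
  ℚ.toℚᵘ ((a * i) ℚ./ suc k)                  ∎)
  where open ℚᵘP.≃-Reasoning

*-/-cancelˡ : ∀ x d {{_ : ℕ.NonZero d}} → (+ d * x) ℚ./ d ≡ x ℚ./ 1
*-/-cancelˡ x zero    {{()}}
*-/-cancelˡ x (suc k) = ℚP.toℚᵘ-injective (begin
  ℚ.toℚᵘ ((+ suc k * x) ℚ./ suc k)            ≈⟨ toℚᵘ-/suc (+ suc k * x) k ⟩
  mkℚᵘ (+ suc k * x) k                        ≈⟨ *≡* (regroup (+ suc k) x) ⟩
  mkℚᵘ x 0                                    ≈⟨ ℚᵘP.≃-sym (toℚᵘ-/suc x 0) ⟩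
  ℚ.toℚᵘ (x ℚ./ 1)                            ∎)
  where
  open ℚᵘP.≃-Reasoning
  regroup : ∀ d x → d * x * 1ℤ ≡ x * d
  regroup = solve-∀

sumℚ-*ˡ : ∀ j (f g : ℕ → ℚ) c → (∀ k → k < j → f k ≡ c ℚ.* g k) → sumℚ j f ≡ c ℚ.* sumℚ j g
sumℚ-*ˡ zero    f g c f≗cg = sym (ℚP.*-zeroʳ c)
sumℚ-*ˡ (suc j) f g c f≗cg =
  trans (cong₂ ℚ._+_ (sumℚ-*ˡ j f g c (λ k k<j → f≗cg k (ℕP.m<n⇒m<1+n k<j))) (f≗cg j ℕP.≤-refl))
        (sym (ℚP.*-distribˡ-+ c (sumℚ j g) (g j)))

∸-∸1-suc : ∀ m k → k < m → suc m ∸ k ∸ 1 ≡ suc (m ∸ k ∸ 1)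
∸-∸1-suc (suc m) zero    _         = refl
∸-∸1-suc (suc m) (suc k) (s≤s k<m) = ∸-∸1-suc m k k<m

term-suc : ∀ m k → k < m → term (suc m) k ≡ (+ 2 ℚ./ 1) ℚ.* term m k
term-suc m k k<m rewrite ∸-∸1-suc m k k<m = begin
  ((sgn k * + (2 ℕ.* 2 ^ e)) ℚ./ (k !)) {{k !≢0}}
    ≡⟨ cong (λ a → (a ℚ./ (k !)) {{k !≢0}}) (trans (cong (sgn k *_) (ℤP.pos-* 2 (2 ^ e))) (swap (sgn k) (+ (2 ^ e)))) ⟩
  ((+ 2 * (sgn k * + (2 ^ e))) ℚ./ (k !)) {{k !≢0}} ≡⟨ sym (/1-*-/ (+ 2) (sgn k * + (2 ^ e)) (k !) {{k !≢0}}) ⟩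
  (+ 2 ℚ./ 1) ℚ.* term m k                          ∎
  where
  open ≡-Reasoning
  e = m ∸ k ∸ 1
  swap : ∀ s y → s * (+ 2 * y) ≡ + 2 * (s * y)
  swap = solve-∀

term-last : ∀ m → term (suc m) m ≡ (sgn m ℚ./ (m !)) {{m !≢0}}
term-last m rewrite cong (_∸ 1) (ℕP.m+n∸n≡m 1 m) = cong (λ a → (a ℚ./ (m !)) {{m !≢0}}) (ℤP.*-identityʳ (sgn m))

factorial*sumℚ≡scaledSum : ∀ n → (+ (n !) ℚ./ 1) ℚ.* sumℚ n (term n) ≡ scaledSum n ℚ./ 1
factorial*sumℚ≡scaledSum zero    = ℚP.*-zeroʳ (+ 1 ℚ./ 1)
factorial*sumℚ≡scaledSum (suc m) = begin
  (+ (suc m ℕ.* m !) ℚ./ 1) ℚ.* (sumℚ m (term (suc m)) ℚ.+ term (suc m) m)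
    ≡⟨ cong₂ ℚ._*_ (trans (cong (ℚ._/ 1) (ℤP.pos-* (suc m) (m !))) (sym (/1-*-/ (+ suc m) (+ (m !)) 1)))
                   (cong₂ ℚ._+_ (sumℚ-*ˡ m (term (suc m)) (term m) two (term-suc m)) (term-last m)) ⟩
  (M ℚ.* F) ℚ.* (two ℚ.* S ℚ.+ X)               ≡⟨ distribute M F two S X ⟩
  M ℚ.* (two ℚ.* (F ℚ.* S) ℚ.+ F ℚ.* X)         ≡⟨ cong₂ (λ a b → M ℚ.* (two ℚ.* a ℚ.+ b)) (factorial*sumℚ≡scaledSum m) F*X ⟩
  M ℚ.* (two ℚ.* (scaledSum m ℚ./ 1) ℚ.+ (sgn m ℚ./ 1)) ≡⟨ cong (λ a → M ℚ.* (a ℚ.+ (sgn m ℚ./ 1))) (/1-*-/ (+ 2) (scaledSum m) 1) ⟩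
  M ℚ.* ((+ 2 * scaledSum m) ℚ./ 1 ℚ.+ (sgn m ℚ./ 1))   ≡⟨ cong (M ℚ.*_) (/1-+ (+ 2 * scaledSum m) (sgn m)) ⟩
  M ℚ.* ((+ 2 * scaledSum m + sgn m) ℚ./ 1)             ≡⟨ /1-*-/ (+ suc m) (+ 2 * scaledSum m + sgn m) 1 ⟩
  (+ suc m * (+ 2 * scaledSum m + sgn m)) ℚ./ 1         ≡⟨ cong (ℚ._/ 1) (regroup (+ suc m) (scaledSum m) (sgn m)) ⟩
  scaledSum (suc m) ℚ./ 1                               ∎
  where
  open ≡-Reasoning
  M = + suc m ℚ./ 1
  F = + (m !) ℚ./ 1
  two = + 2 ℚ./ 1
  S = sumℚ m (term m)
  X = (sgn m ℚ./ (m !)) {{m !≢0}}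
  F*X : F ℚ.* X ≡ sgn m ℚ./ 1
  F*X = trans (/1-*-/ (+ (m !)) (sgn m) (m !) {{m !≢0}}) (*-/-cancelˡ (sgn m) (m !) {{m !≢0}})
  distribute : ∀ M F t S X → (M ℚ.* F) ℚ.* (t ℚ.* S ℚ.+ X) ≡ M ℚ.* (t ℚ.* (F ℚ.* S) ℚ.+ F ℚ.* X)
  distribute = ℚ-solve 5 (λ M F t S X → (M :* F) :* (t :* S :+ X) := M :* (t :* (F :* S) :+ F :* X)) refl
  regroup : ∀ M g s → M * (+ 2 * g + s) ≡ + 2 * M * g + M * s
  regroup = solve-∀

theorem1p2 :
  ((n : ℕ) → n ≥ 1 →
     (+ dAB n ℚ./ 1) ≡ (+ (n !) ℚ./ 1) ℚ.* sumℚ n (term n) ℚ.+ (sgn n ℚ./ 1))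
  × (dAB 1 ≡ 0)
  × ((n : ℕ) → n ≥ 2 →
     + dAB n ≡ + (2 ℕ.* n) ℤ.* + dAB (n ℕ.∸ 1) ℤ.+ sgn n ℤ.* + (n ℕ.+ 1))
  × (dAB 2 ≡ 3)
  × ((n : ℕ) → n ≥ 3 →
     + dAB n ≡ + (n ℕ.∸ 1) ℤ.* (+ 2 ℤ.* + dAB (n ℕ.∸ 1) ℤ.+ + 4 ℤ.* + dAB (n ℕ.∸ 2) ℤ.+ sgn (n ℕ.∸ 1)))
theorem1p2 = explicit , dAB-1 , first-order , dAB-2 , second-order
  where
  open Recurrence (λ n → + dAB n) dAB-suc
  explicit : (n : ℕ) → n ≥ 1 → (+ dAB n ℚ./ 1) ≡ (+ (n !) ℚ./ 1) ℚ.* sumℚ n (term n) ℚ.+ (sgn n ℚ./ 1)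
  explicit (suc m) _ = sym (begin
    (+ (suc m !) ℚ./ 1) ℚ.* sumℚ (suc m) (term (suc m)) ℚ.+ (sgn (suc m) ℚ./ 1)
      ≡⟨ cong (ℚ._+ (sgn (suc m) ℚ./ 1)) (factorial*sumℚ≡scaledSum (suc m)) ⟩
    (scaledSum (suc m) ℚ./ 1) ℚ.+ (sgn (suc m) ℚ./ 1)  ≡⟨ /1-+ (scaledSum (suc m)) (sgn (suc m)) ⟩
    (scaledSum (suc m) + sgn (suc m)) ℚ./ 1            ≡⟨ cong (ℚ._/ 1) (sym (≡scaledSum+sgn (cong +_ dAB-1) m)) ⟩
    + dAB (suc m) ℚ./ 1                        ∎)
    where open ≡-Reasoning
  first-order : (n : ℕ) → n ≥ 2 → + dAB n ≡ + (2 ℕ.* n) * + dAB (n ∸ 1) + sgn n * + (n ℕ.+ 1)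
  first-order (suc zero)    (s≤s ())
  first-order (suc (suc m)) _ = dAB-suc (suc m)
  second-order : (n : ℕ) → n ≥ 3 →
    + dAB n ≡ + (n ∸ 1) * (+ 2 * + dAB (n ∸ 1) + + 4 * + dAB (n ∸ 2) + sgn (n ∸ 1))
  second-order (suc zero)          (s≤s ())
  second-order (suc (suc zero))    (s≤s (s≤s ()))
  second-order (suc (suc (suc m))) _ = three-term (suc m)
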